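{- For every positive integer $\Delta$ and all positive reals $\beta$ and $\mu_S$ there is $\mu_T>0$ such that the following holds. Let $S$ and $T$ be disjoint sets with $|S|\le|T|$, let $\mathcal S\subseteq\binom S\Delta$ be a family of pairwise disjoint $\Delta$-sets with $|\mathcal S|\le\frac1\Delta(1-\mu_S)|T|$, and let $\mathcal T\subseteq\binom T\Delta$ be a family of $\Delta$-sets with $|\mathcal T|\le\mu_T|T|^\Delta$. Then a uniformly random injective function $f\colon S\to T$ satisfies $|f(\mathcal S)\setminus\mathcal T|>(1-\beta)|\mathcal S|$ with probability at least $1-\beta^{|\mathcal S|}$.
   Context: $f(\mathcal S)=\{f(A)\colon A\in\mathcal S\}$, where $f(A)$ is the image of the set $A$.
   Formalization: The parameters $\beta$ and $\mu_S$ range over the positive rationals instead of the positive reals. -}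

module Defs where

open import Data.Nat as ℕ using (ℕ; zero; suc)
open import Data.Integer using (+_)
open import Data.Rational as ℚ using (ℚ; 1ℚ; _/_; _*_)
open import Data.Bool using (Bool)
open import Data.Fin using (Fin; _≟_)
open import Data.Fin.Properties using (any?; all?)
open import Data.Fin.Subset using (Subset; _∈_)
open import Data.Fin.Subset.Properties using (_∈?_)
open import Data.Vec using (Vec; []; _∷_; lookup; tabulate)
open import Data.Vec.Properties using (≡-dec)
open import Data.Bool.Properties renaming (_≟_ to _≟ᵇ_)
open import Data.List using (List; []; _∷_; [_]; map; concatMap; allFin; filter; deduplicate; length)

open import Data.List.Relation.Unary.Any using () renaming (any? to anyL?)
open import Data.Product using (_×_; _,_)
open import Relation.Nullary using (Dec; does; ¬?; _×-dec_; _→-dec_)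
open import Relation.Binary.PropositionalEquality using (_≡_)

⟦_⟧ : ℕ → ℚ
⟦ n ⟧ = + n / 1

_^ℚ_ : ℚ → ℕ → ℚ
q ^ℚ zero = 1ℚ
q ^ℚ suc n = q * (q ^ℚ n)

-- A function f : Fin s → Fin t is represented by its table (Vec (Fin t) s).
-- All functions Fin s → Fin t, each exactly once.
allFuns : (s t : ℕ) → List (Vec (Fin t) s)
allFuns zero t = [ [] ]
allFuns (suc s) t = concatMap (λ v → map (λ y → y ∷ v) (allFin t)) (allFuns s t)

Injective : ∀ {s t} → Vec (Fin t) s → Set
Injective {s} f = (i j : Fin s) → lookup f i ≡ lookup f j → i ≡ j

injective? : ∀ {s t} (f : Vec (Fin t) s) → Dec (Injective f)
injective? f = all? (λ i → all? (λ j → (lookup f i ≟ lookup f j) →-dec (i ≟ j)))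

-- All injective functions Fin s → Fin t (each exactly once): the sample space.
allInjections : (s t : ℕ) → List (Vec (Fin t) s)
allInjections s t = filter injective? (allFuns s t)

image : ∀ {s t} → Vec (Fin t) s → Subset s → Subset t
image f A = tabulate (λ y → does (any? (λ i → (i ∈? A) ×-dec (lookup f i ≟ y))))

_≟ˢ_ : ∀ {n} (A B : Subset n) → Dec (A ≡ B)
_≟ˢ_ = ≡-dec _≟ᵇ_

imageFamily : ∀ {s t} → Vec (Fin t) s → List (Subset s) → List (Subset t)
imageFamily f 𝒮 = deduplicate _≟ˢ_ (map (image f) 𝒮)

countImageOutside : ∀ {s t} → Vec (Fin t) s → List (Subset s) → List (Subset t) → ℕ
countImageOutside f 𝒮 𝒯 =
  length (filter (λ B → ¬? (anyL? (λ C → B ≟ˢ C) 𝒯)) (imageFamily f 𝒮))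

module Submission where

-- Everything is counted exactly over the list of all injections.  The
-- combinatorial core (FiberBound) bounds the injections that avoid a set F
-- and map given disjoint sources A₁,…,A_j onto given disjoint targets by
-- ∏ |A_k|! · (t − |F| − D)(t − |F| − D − 1)⋯, with D = ∑ |A_k|; conversely
-- (InjectionCount) there are at least t(t−1)⋯(t−s+1) injections.  An injection f with |f(𝒮) ∖ 𝒯| ≤ (1 − β)|𝒮|
-- maps a sublist of size ≥ β|𝒮| into 𝒯, so a union bound over the 2^|𝒮|
-- sublists with c = (β/2)^M (M the denominator of β) bounds the bad
-- injections by β^|𝒮| of all (Probability); the theorem follows.

module Sums where

  open import Data.Nat using (ℕ; zero; suc; _+_; _*_; _≤_; z≤n; s≤s)
  open import Data.Nat.Properties
  open import Data.Bool using (Bool; true; false)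
  open import Data.Fin using (Fin; zero; suc)
  open import Data.List using (List; []; _∷_; _++_; map; concatMap; filter; length)
  import Data.List as List
  open import Data.List.Relation.Unary.All using (All; []; _∷_)
  open import Data.List.Relation.Unary.Any using (Any; here; there)
  open import Data.Empty using (⊥-elim)
  open import Relation.Nullary using (Dec; yes; no; does; ¬?; _×-dec_)
  open import Relation.Unary using (Decidable)
  open import Relation.Binary.PropositionalEquality
  open import Algebra.Properties.Semiring.Sum +-*-semiring public
    using (sum; sum-cong-≗; ∑-distrib-+)
  open import Algebra.Properties.Semiring.Sum +-*-semiring
    using (*-distribˡ-sum)
  open import Algebra.Properties.CommutativeSemigroup +-commutativeSemigroup
    using () renaming (interchange to +-interchange)
  open import Algebra.Properties.CommutativeSemigroup *-commutativeSemigroup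
    using () renaming (interchange to *-interchange)

  bit : Bool → ℕ
  bit true = 1
  bit false = 0

  ind : ∀ {p} {P : Set p} → Dec P → ℕ
  ind d = bit (does d)

  ind-mono : ∀ {p q} {P : Set p} {Q : Set q} (P? : Dec P) (Q? : Dec Q) → (P → Q) → ind P? ≤ ind Q?
  ind-mono (yes p) (yes q) h = ≤-refl
  ind-mono (yes p) (no ¬q) h = ⊥-elim (¬q (h p))
  ind-mono (no ¬p) Q? h = z≤n

  ind-yes : ∀ {p} {P : Set p} (P? : Dec P) → P → ind P? ≡ 1
  ind-yes (yes p) _ = refl
  ind-yes (no ¬p) p = ⊥-elim (¬p p)

  ind≤1 : ∀ {p} {P : Set p} (P? : Dec P) → ind P? ≤ 1
  ind≤1 (yes _) = ≤-refl
  ind≤1 (no _) = z≤n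

  ind-× : ∀ {p q} {P : Set p} {Q : Set q} (P? : Dec P) (Q? : Dec Q) → ind (P? ×-dec Q?) ≡ ind P? * ind Q?
  ind-× (yes p) (yes q) = refl
  ind-× (yes p) (no q) = refl
  ind-× (no p) Q? = refl

  ind-¬ : ∀ {p} {P : Set p} (P? : Dec P) → ind P? + ind (¬? P?) ≡ 1
  ind-¬ (yes p) = refl
  ind-¬ (no p) = refl

  sum-mono : ∀ {n} (f g : Fin n → ℕ) → (∀ i → f i ≤ g i) → sum f ≤ sum g
  sum-mono {zero} f g h = z≤n
  sum-mono {suc n} f g h = +-mono-≤ (h zero) (sum-mono _ _ (λ i → h (suc i)))

  sum-zero : ∀ n → sum {n} (λ _ → 0) ≡ 0
  sum-zero zero = refl
  sum-zero (suc n) = sum-zero n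

  sum-one : ∀ n → sum {n} (λ _ → 1) ≡ n
  sum-one zero = refl
  sum-one (suc n) = cong suc (sum-one n)

  sum-*ʳ : ∀ {n} (f : Fin n → ℕ) c → sum (λ i → f i * c) ≡ sum f * c
  sum-*ʳ f c = begin
    sum (λ i → f i * c) ≡⟨ sum-cong-≗ (λ i → *-comm (f i) c) ⟩
    sum (λ i → c * f i) ≡⟨ sym (*-distribˡ-sum c f) ⟩
    c * sum f           ≡⟨ *-comm c (sum f) ⟩
    sum f * c           ∎
    where open ≡-Reasoning

  sum-delta : ∀ {n} (y : Fin n) → sum (λ z → ind (z Data.Fin.≟ y)) ≡ 1
  sum-delta {suc n} zero = cong suc (sum-zero n)
  sum-delta {suc n} (suc y) = sum-delta y

  ∑ˡ : ∀ {a} {A : Set a} → (A → ℕ) → List A → ℕ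
  ∑ˡ f [] = 0
  ∑ˡ f (x ∷ xs) = f x + ∑ˡ f xs

  ∏ˡ : ∀ {a} {A : Set a} → (A → ℕ) → List A → ℕ
  ∏ˡ f [] = 1
  ∏ˡ f (x ∷ xs) = f x * ∏ˡ f xs

  module _ {a} {A : Set a} where

    ∑ˡ-mono : ∀ (f g : A → ℕ) xs → (∀ x → f x ≤ g x) → ∑ˡ f xs ≤ ∑ˡ g xs
    ∑ˡ-mono f g [] h = z≤n
    ∑ˡ-mono f g (x ∷ xs) h = +-mono-≤ (h x) (∑ˡ-mono f g xs h)

    ∑ˡ-cong : ∀ (f g : A → ℕ) xs → (∀ x → f x ≡ g x) → ∑ˡ f xs ≡ ∑ˡ g xs
    ∑ˡ-cong f g [] h = refl
    ∑ˡ-cong f g (x ∷ xs) h = cong₂ _+_ (h x) (∑ˡ-cong f g xs h)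

    ∑ˡ-cong-All : ∀ (f g : A → ℕ) xs → All (λ x → f x ≡ g x) xs → ∑ˡ f xs ≡ ∑ˡ g xs
    ∑ˡ-cong-All f g [] [] = refl
    ∑ˡ-cong-All f g (x ∷ xs) (e ∷ es) = cong₂ _+_ e (∑ˡ-cong-All f g xs es)

    ∑ˡ-bound : ∀ (f : A → ℕ) c xs → All (λ x → f x ≤ c) xs → ∑ˡ f xs ≤ length xs * c
    ∑ˡ-bound f c [] [] = z≤n
    ∑ˡ-bound f c (x ∷ xs) (p ∷ ps) = +-mono-≤ p (∑ˡ-bound f c xs ps)

    ∑ˡ-const : ∀ c (xs : List A) → ∑ˡ (λ _ → c) xs ≡ length xs * c
    ∑ˡ-const c [] = refl
    ∑ˡ-const c (x ∷ xs) = cong (c +_) (∑ˡ-const c xs)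

    ∑ˡ-zero : ∀ (f : A → ℕ) xs → All (λ x → f x ≡ 0) xs → ∑ˡ f xs ≡ 0
    ∑ˡ-zero f xs zs = trans (∑ˡ-cong-All f (λ _ → 0) xs zs) (trans (∑ˡ-const 0 xs) (*-zeroʳ (length xs)))

    ∑ˡ-++ : ∀ (f : A → ℕ) xs ys → ∑ˡ f (xs ++ ys) ≡ ∑ˡ f xs + ∑ˡ f ys
    ∑ˡ-++ f [] ys = refl
    ∑ˡ-++ f (x ∷ xs) ys = trans (cong (f x +_) (∑ˡ-++ f xs ys)) (sym (+-assoc (f x) _ _))

    ∑ˡ-+ : ∀ (f g : A → ℕ) xs → ∑ˡ (λ x → f x + g x) xs ≡ ∑ˡ f xs + ∑ˡ g xs
    ∑ˡ-+ f g [] = refl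
    ∑ˡ-+ f g (x ∷ xs) = trans (cong (f x + g x +_) (∑ˡ-+ f g xs)) (+-interchange (f x) (g x) (∑ˡ f xs) (∑ˡ g xs))

    ∑ˡ-*ˡ : ∀ c (f : A → ℕ) xs → ∑ˡ (λ x → c * f x) xs ≡ c * ∑ˡ f xs
    ∑ˡ-*ˡ c f [] = sym (*-zeroʳ c)
    ∑ˡ-*ˡ c f (x ∷ xs) = trans (cong (c * f x +_) (∑ˡ-*ˡ c f xs)) (sym (*-distribˡ-+ c (f x) _))

    ∑ˡ-sum-swap : ∀ {n} (g : A → Fin n → ℕ) xs → ∑ˡ (λ x → sum (g x)) xs ≡ sum (λ y → ∑ˡ (λ x → g x y) xs)
    ∑ˡ-sum-swap {n} g [] = sym (sum-zero n)
    ∑ˡ-sum-swap g (x ∷ xs) = trans (cong (sum (g x) +_) (∑ˡ-sum-swap g xs)) (sym (∑-distrib-+ (g x) _))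

    length-filter-∑ˡ : ∀ {p} {P : A → Set p} (P? : Decidable P) xs → length (filter P? xs) ≡ ∑ˡ (λ x → ind (P? x)) xs
    length-filter-∑ˡ P? [] = refl
    length-filter-∑ˡ P? (x ∷ xs) with does (P? x)
    ... | true = cong suc (length-filter-∑ˡ P? xs)
    ... | false = length-filter-∑ˡ P? xs

    ∑ˡ-filter : ∀ {p} {P : A → Set p} (P? : Decidable P) (f : A → ℕ) xs →
      ∑ˡ f (filter P? xs) ≡ ∑ˡ (λ x → ind (P? x) * f x) xs
    ∑ˡ-filter P? f [] = refl
    ∑ˡ-filter P? f (x ∷ xs) with does (P? x)
    ... | true = cong₂ _+_ (sym (+-identityʳ (f x))) (∑ˡ-filter P? f xs)
    ... | false = ∑ˡ-filter P? f xs

    Any⇒ind≤∑ˡ : ∀ {p q} {P : Set p} {Q : A → Set q} (P? : Dec P) (Q? : Decidable Q) xs →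
      (P → Any Q xs) → ind P? ≤ ∑ˡ (λ x → ind (Q? x)) xs
    Any⇒ind≤∑ˡ (no _) Q? xs h = z≤n
    Any⇒ind≤∑ˡ (yes p) Q? xs h = go xs (h p)
      where
      go : ∀ xs → Any _ xs → 1 ≤ ∑ˡ (λ x → ind (Q? x)) xs
      go (x ∷ xs) (here q) rewrite ind-yes (Q? x) q = s≤s z≤n
      go (x ∷ xs) (there a) = ≤-trans (go xs a) (m≤n+m _ _)

    ∑ˡ-tabulate : ∀ {n} (f : A → ℕ) (g : Fin n → A) → ∑ˡ f (List.tabulate g) ≡ sum (λ i → f (g i))
    ∑ˡ-tabulate {zero} f g = refl
    ∑ˡ-tabulate {suc n} f g = cong (f (g zero) +_) (∑ˡ-tabulate f (λ i → g (suc i)))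

    ∏ˡ-cong : ∀ (f g : A → ℕ) xs → (∀ x → f x ≡ g x) → ∏ˡ f xs ≡ ∏ˡ g xs
    ∏ˡ-cong f g [] h = refl
    ∏ˡ-cong f g (x ∷ xs) h = cong₂ _*_ (h x) (∏ˡ-cong f g xs h)

    ∏ˡ-* : ∀ (f g : A → ℕ) xs → ∏ˡ (λ x → f x * g x) xs ≡ ∏ˡ f xs * ∏ˡ g xs
    ∏ˡ-* f g [] = refl
    ∏ˡ-* f g (x ∷ xs) = trans (cong (f x * g x *_) (∏ˡ-* f g xs)) (*-interchange (f x) (g x) (∏ˡ f xs) (∏ˡ g xs))

    ∏ˡ-pos : ∀ (f : A → ℕ) xs → (∀ x → 1 ≤ f x) → 1 ≤ ∏ˡ f xs
    ∏ˡ-pos f [] h = ≤-refl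
    ∏ˡ-pos f (x ∷ xs) h = *-mono-≤ (h x) (∏ˡ-pos f xs h)

  module _ {a b} {A : Set a} {B : Set b} where

    ∑ˡ-map : ∀ (f : B → ℕ) (g : A → B) xs → ∑ˡ f (map g xs) ≡ ∑ˡ (λ x → f (g x)) xs
    ∑ˡ-map f g [] = refl
    ∑ˡ-map f g (x ∷ xs) = cong (f (g x) +_) (∑ˡ-map f g xs)

    ∏ˡ-map : ∀ (f : B → ℕ) (g : A → B) xs → ∏ˡ f (map g xs) ≡ ∏ˡ (λ x → f (g x)) xs
    ∏ˡ-map f g [] = refl
    ∏ˡ-map f g (x ∷ xs) = cong (f (g x) *_) (∏ˡ-map f g xs)

    ∑ˡ-concatMap : ∀ (f : B → ℕ) (h : A → List B) xs → ∑ˡ f (concatMap h xs) ≡ ∑ˡ (λ x → ∑ˡ f (h x)) xs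
    ∑ˡ-concatMap f h [] = refl
    ∑ˡ-concatMap f h (x ∷ xs) = trans (∑ˡ-++ f (h x) (concatMap h xs)) (cong (∑ˡ f (h x) +_) (∑ˡ-concatMap f h xs))

    ∑ˡ-swap : ∀ (g : A → B → ℕ) xs ys →
      ∑ˡ (λ x → ∑ˡ (g x) ys) xs ≡ ∑ˡ (λ y → ∑ˡ (λ x → g x y) xs) ys
    ∑ˡ-swap g [] ys = sym (trans (∑ˡ-const 0 ys) (*-zeroʳ (length ys)))
    ∑ˡ-swap g (x ∷ xs) ys = trans (cong (∑ˡ (g x) ys +_) (∑ˡ-swap g xs ys)) (sym (∑ˡ-+ (g x) _ ys))

module Images where

  open import Defs
  open Sums
  open import Data.Nat using (ℕ; zero; suc)
  open import Data.Bool using (Bool; true; false; _∧_; _∨_)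
  open import Data.Fin using (Fin; zero; suc) renaming (_≟_ to _≟ᶠ_)
  open import Data.Fin.Properties using (any?) renaming (suc-injective to Fin-suc-injective)
  open import Data.Fin.Subset using (Subset)
  open import Data.Fin.Subset.Properties using (_∈?_)
  open import Data.Vec using (Vec; _∷_; lookup)
  open import Data.Vec.Properties using (lookup∘tabulate; []=⇒lookup; lookup⇒[]=)
  open import Data.List using (map; allFin; concatMap)
  open import Data.Product using (∃; _×_; _,_)
  open import Data.Empty using (⊥; ⊥-elim)
  open import Relation.Nullary using (yes; no; does; _×-dec_)
  open import Relation.Unary using (Pred; Decidable)
  open import Relation.Binary.PropositionalEquality

  hits : ∀ {s t} → Vec (Fin t) s → Subset s → Fin t → Bool
  hits f A z = does (any? (λ i → (i ∈? A) ×-dec (lookup f i ≟ᶠ z)))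

  lookup-image : ∀ {s t} (f : Vec (Fin t) s) (A : Subset s) (z : Fin t) → lookup (image f A) z ≡ hits f A z
  lookup-image f A z = lookup∘tabulate _ z

  any?-cong : ∀ {n p q} {P : Pred (Fin n) p} {Q : Pred (Fin n) q} (P? : Decidable P) (Q? : Decidable Q) →
    (∀ i → does (P? i) ≡ does (Q? i)) → does (any? P?) ≡ does (any? Q?)
  any?-cong {zero} P? Q? e = refl
  any?-cong {suc n} P? Q? e = cong₂ _∨_ (e zero) (any?-cong (λ i → P? (suc i)) (λ i → Q? (suc i)) (λ i → e (suc i)))

  hits-∷ : ∀ {s t} (y : Fin t) (v : Vec (Fin t) s) (x : Bool) (A : Subset s) (z : Fin t) →
    hits (y ∷ v) (x ∷ A) z ≡ ((x ∧ does (y ≟ᶠ z)) ∨ hits v A z)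
  hits-∷ y v true A z = cong (does (y ≟ᶠ z) ∨_)
    (any?-cong (λ i → (suc i ∈? (true ∷ A)) ×-dec (lookup v i ≟ᶠ z)) (λ i → (i ∈? A) ×-dec (lookup v i ≟ᶠ z)) (λ i → refl))
  hits-∷ y v false A z =
    any?-cong (λ i → (suc i ∈? (false ∷ A)) ×-dec (lookup v i ≟ᶠ z)) (λ i → (i ∈? A) ×-dec (lookup v i ≟ᶠ z)) (λ i → refl)

  hits⇒preimage : ∀ {s t} (f : Vec (Fin t) s) (A : Subset s) (z : Fin t) → hits f A z ≡ true →
    ∃ λ i → lookup A i ≡ true × lookup f i ≡ z
  hits⇒preimage f A z e with any? (λ i → (i ∈? A) ×-dec (lookup f i ≟ᶠ z))
  ... | yes (i , i∈A , fi≡z) = i , []=⇒lookup i∈A , fi≡z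
  hits⇒preimage f A z () | no _

  preimage⇒hits : ∀ {s t} (f : Vec (Fin t) s) (A : Subset s) (i : Fin s) →
    lookup A i ≡ true → hits f A (lookup f i) ≡ true
  preimage⇒hits f A i ai with any? (λ j → (j ∈? A) ×-dec (lookup f j ≟ᶠ lookup f i))
  ... | yes _ = refl
  ... | no ¬p = ⊥-elim (¬p (i , lookup⇒[]= i A ai , refl))

  no-preimage⇒¬hits : ∀ {s t} (f : Vec (Fin t) s) (A : Subset s) (z : Fin t) →
    (∀ i → lookup f i ≡ z → ⊥) → hits f A z ≡ false
  no-preimage⇒¬hits f A z h with hits f A z in eq
  ... | false = refl
  ... | true with hits⇒preimage f A z eq
  ... | i , _ , fi = ⊥-elim (h i fi)

  injective-tail : ∀ {s t} {y : Fin t} {v : Vec (Fin t) s} → Injective (y ∷ v) → Injective v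
  injective-tail inj i j e = Fin-suc-injective (inj (suc i) (suc j) e)

  injective-head : ∀ {s t} {y : Fin t} {v : Vec (Fin t) s} → Injective (y ∷ v) → ∀ i → lookup v i ≡ y → ⊥
  injective-head inj i e with inj (suc i) zero e
  ... | ()

  injective-∷ : ∀ {s t} {y : Fin t} {v : Vec (Fin t) s} → Injective v → (∀ i → lookup v i ≡ y → ⊥) → Injective (y ∷ v)
  injective-∷ inj h zero zero e = refl
  injective-∷ inj h zero (suc j) e = ⊥-elim (h j (sym e))
  injective-∷ inj h (suc i) zero e = ⊥-elim (h i e)
  injective-∷ inj h (suc i) (suc j) e = cong suc (inj i j e)

  count : ∀ {s t} {P : Vec (Fin t) s → Set} → Decidable P → ℕ
  count {s} {t} P? = ∑ˡ (λ v → ind (P? v)) (allFuns s t)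

  ∑ˡ-allFuns-suc : ∀ s t (g : Vec (Fin t) (suc s) → ℕ) →
    ∑ˡ g (allFuns (suc s) t) ≡ sum (λ y → ∑ˡ (λ v → g (y ∷ v)) (allFuns s t))
  ∑ˡ-allFuns-suc s t g = begin
    ∑ˡ g (concatMap (λ v → map (λ y → y ∷ v) (allFin t)) (allFuns s t))
      ≡⟨ ∑ˡ-concatMap g _ (allFuns s t) ⟩
    ∑ˡ (λ v → ∑ˡ g (map (λ y → y ∷ v) (allFin t))) (allFuns s t)
      ≡⟨ ∑ˡ-cong _ _ (allFuns s t) (λ v → trans (∑ˡ-map g (λ y → y ∷ v) (allFin t)) (∑ˡ-tabulate (λ y → g (y ∷ v)) (λ i → i))) ⟩
    ∑ˡ (λ v → sum (λ y → g (y ∷ v))) (allFuns s t)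
      ≡⟨ ∑ˡ-sum-swap (λ v y → g (y ∷ v)) (allFuns s t) ⟩
    sum (λ y → ∑ˡ (λ v → g (y ∷ v)) (allFuns s t)) ∎
    where open ≡-Reasoning

module FiberBound where

  open import Defs
  open Sums
  open Images
  open import Data.Nat using (ℕ; zero; suc; _+_; _*_; _∸_; _^_; _≤_; z≤n; s≤s; _!; >-nonZero)
  open import Data.Nat.Properties
  open import Data.Bool using (Bool; true; false; _∧_; _∨_; not; if_then_else_)
  open import Data.Bool.Properties using (∧-zeroʳ; ∧-identityʳ) renaming (_≟_ to _≟ᵇ_)
  open import Data.Fin using (Fin; zero; suc) renaming (_≟_ to _≟ᶠ_)
  open import Data.Fin.Properties using (all?)
  open import Data.Fin.Subset using (Subset; ∣_∣)
  open import Data.Vec using (Vec; []; _∷_; lookup; head; tail)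
  open import Data.List using (List; []; _∷_; map)
  open import Data.List.Relation.Unary.All as All using (All; []; _∷_)
  open import Data.Product using (_×_; _,_; proj₁; proj₂)
  open import Data.Sum using (_⊎_; inj₁; inj₂)
  open import Data.Empty using (⊥)
  open import Relation.Nullary using (Dec; yes; no; does; _×-dec_)
  open import Relation.Nullary.Decidable using (dec-true; dec-false)
  open import Relation.Binary.PropositionalEquality
  open import Algebra.Properties.CommutativeSemigroup *-commutativeSemigroup
    using () renaming (x∙yz≈y∙xz to x*[y*z]≡y*[x*z])

  -- Proof by induction on s, choosing the first value y of f:
  -- the remaining table meets the constraints with the first point removed
  -- from the sources and y removed from the targets, and avoids F ∪ {y}.

  fall : ℕ → ℕ → ℕ
  fall n zero = 1
  fall n (suc k) = n * fall (n ∸ 1) k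

  fall-+ : ∀ n a k → fall n (a + k) ≡ fall n a * fall (n ∸ a) k
  fall-+ n zero k = sym (+-identityʳ (fall n k))
  fall-+ n (suc a) k = begin
    n * fall (n ∸ 1) (a + k)                   ≡⟨ cong (n *_) (fall-+ (n ∸ 1) a k) ⟩
    n * (fall (n ∸ 1) a * fall (n ∸ 1 ∸ a) k)  ≡⟨ sym (*-assoc n _ _) ⟩
    n * fall (n ∸ 1) a * fall (n ∸ 1 ∸ a) k    ≡⟨ cong (λ w → n * fall (n ∸ 1) a * fall w k) (∸-+-assoc n 1 a) ⟩
    n * fall (n ∸ 1) a * fall (n ∸ suc a) k    ∎
    where open ≡-Reasoning

  -- every factor is at least n − a
  fall-lower : ∀ n a → (n ∸ a) ^ a ≤ fall n a
  fall-lower n zero = ≤-refl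
  fall-lower n (suc a) = *-mono-≤ (m∸n≤m n (suc a)) (subst (λ w → w ^ a ≤ fall (n ∸ 1) a) (∸-+-assoc n 1 a) (fall-lower (n ∸ 1) a))

  #_ : ∀ {t} → (Fin t → Bool) → ℕ
  # B = sum (λ z → bit (B z))

  nothing : ∀ {t} → Fin t → Bool
  nothing _ = false

  ∣∣≡# : ∀ {n} (A : Subset n) → ∣ A ∣ ≡ # (lookup A)
  ∣∣≡# [] = refl
  ∣∣≡# (true ∷ A) = cong suc (∣∣≡# A)
  ∣∣≡# (false ∷ A) = ∣∣≡# A

  Constraint : ℕ → ℕ → Set
  Constraint s t = Subset s × (Fin t → Bool)

  Meets : ∀ {s t} → Vec (Fin t) s → Constraint s t → Set
  Meets f (A , B) = ∀ z → hits f A z ≡ B z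

  Meets? : ∀ {s t} (f : Vec (Fin t) s) (c : Constraint s t) → Dec (Meets f c)
  Meets? f (A , B) = all? (λ z → hits f A z ≟ᵇ B z)

  Admissible : ∀ {s t} → (Fin t → Bool) → List (Constraint s t) → Vec (Fin t) s → Set
  Admissible F Cs f = Injective f × (∀ i → F (lookup f i) ≡ false) × All (Meets f) Cs

  Admissible? : ∀ {s t} (F : Fin t → Bool) (Cs : List (Constraint s t)) (f : Vec (Fin t) s) → Dec (Admissible F Cs f)
  Admissible? F Cs f = injective? f ×-dec all? (λ i → F (lookup f i) ≟ᵇ false) ×-dec All.all? (Meets? f) Cs

  SourcesDisjoint : ∀ {s t} → List (Constraint s t) → Set
  SourcesDisjoint {s} Cs = ∀ (i : Fin s) → ∑ˡ (λ c → bit (lookup (proj₁ c) i)) Cs ≤ 1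

  SizesMatch : ∀ {s t} → List (Constraint s t) → Set
  SizesMatch Cs = All (λ c → ∣ proj₁ c ∣ ≡ # proj₂ c) Cs

  TargetsDisjoint : ∀ {s t} → (Fin t → Bool) → List (Constraint s t) → Set
  TargetsDisjoint {t = t} F Cs = ∀ (z : Fin t) → bit (F z) + ∑ˡ (λ c → bit (proj₂ c z)) Cs ≤ 1

  total : ∀ {s t} → List (Constraint s t) → ℕ
  total = ∑ˡ (λ c → ∣ proj₁ c ∣)

  arrangements : ∀ {s t} → List (Constraint s t) → ℕ
  arrangements = ∏ˡ (λ c → ∣ proj₁ c ∣ !)

  srcHead : ∀ {s t} → Constraint (suc s) t → Bool
  srcHead c = head (proj₁ c)

  srcTail : ∀ {s t} → Constraint (suc s) t → Subset s
  srcTail c = tail (proj₁ c)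

  remove : ∀ {t} → (Fin t → Bool) → Fin t → Fin t → Bool
  remove B y z = B z ∧ not (does (z ≟ᶠ y))

  forbid : ∀ {t} → (Fin t → Bool) → Fin t → Fin t → Bool
  forbid F y z = does (z ≟ᶠ y) ∨ F z

  -- the constraint left for the rest of the table once the first value is y
  restrict : ∀ {s t} → Fin t → Constraint (suc s) t → Constraint s t
  restrict y (x ∷ A , B) = A , (if x then remove B y else B)

  FirstValue : ∀ {s t} → (Fin t → Bool) → List (Constraint (suc s) t) → Fin t → Set
  FirstValue F Cs y = F y ≡ false × All (λ c → proj₂ c y ≡ srcHead c) Cs

  FirstValue? : ∀ {s t} (F : Fin t → Bool) (Cs : List (Constraint (suc s) t)) (y : Fin t) → Dec (FirstValue F Cs y)
  FirstValue? F Cs y = (F y ≟ᵇ false) ×-dec All.all? (λ c → proj₂ c y ≟ᵇ srcHead c) Cs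

  ≟-refl : ∀ {n} (y : Fin n) → does (y ≟ᶠ y) ≡ true
  ≟-refl y = dec-true (y ≟ᶠ y) refl

  sum-bit-split : ∀ {t} (B : Fin t → Bool) (y : Fin t) (B' : Fin t → Bool) →
    (∀ z → bit (B z) ≡ bit (does (z ≟ᶠ y)) + bit (B' z)) → # B ≡ suc (# B')
  sum-bit-split B y B' pw = begin
    # B                                                   ≡⟨ sum-cong-≗ pw ⟩
    sum (λ z → bit (does (z ≟ᶠ y)) + bit (B' z))          ≡⟨ ∑-distrib-+ (λ z → bit (does (z ≟ᶠ y))) (λ z → bit (B' z)) ⟩
    sum (λ z → bit (does (z ≟ᶠ y))) + # B'               ≡⟨ cong (_+ # B') (sum-delta y) ⟩
    suc (# B')                                            ∎
    where open ≡-Reasoning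

  #-remove : ∀ {t} (B : Fin t → Bool) y → B y ≡ true → # B ≡ suc (# remove B y)
  #-remove B y By = sum-bit-split B y (remove B y) pw
    where
    pw : ∀ z → bit (B z) ≡ bit (does (z ≟ᶠ y)) + bit (remove B y z)
    pw z with z ≟ᶠ y
    ... | yes refl rewrite By = refl
    ... | no _ rewrite ∧-identityʳ (B z) = refl

  #-forbid : ∀ {t} (F : Fin t → Bool) y → F y ≡ false → # forbid F y ≡ suc (# F)
  #-forbid F y Fy = sum-bit-split (forbid F y) y F pw
    where
    pw : ∀ z → bit (forbid F y z) ≡ bit (does (z ≟ᶠ y)) + bit (F z)
    pw z with z ≟ᶠ y
    ... | yes refl rewrite Fy = refl
    ... | no _ = refl

  meets-head : ∀ {s t} (y : Fin t) (v : Vec (Fin t) s) (c : Constraint (suc s) t) → Meets (y ∷ v) c →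
    (∀ i → lookup v i ≡ y → ⊥) → proj₂ c y ≡ srcHead c
  meets-head y v (x ∷ A , B) meets avoid = begin
    B y                                 ≡⟨ sym (meets y) ⟩
    hits (y ∷ v) (x ∷ A) y              ≡⟨ hits-∷ y v x A y ⟩
    (x ∧ does (y ≟ᶠ y)) ∨ hits v A y    ≡⟨ cong₂ (λ a b → (x ∧ a) ∨ b) (≟-refl y) (no-preimage⇒¬hits v A y avoid) ⟩
    (x ∧ true) ∨ false                  ≡⟨ x∧true∨false x ⟩
    x                                   ∎
    where
    open ≡-Reasoning
    x∧true∨false : ∀ x → (x ∧ true) ∨ false ≡ x
    x∧true∨false true = refl
    x∧true∨false false = refl

  meets-restrict : ∀ {s t} (y : Fin t) (v : Vec (Fin t) s) (c : Constraint (suc s) t) → Meets (y ∷ v) c →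
    (∀ i → lookup v i ≡ y → ⊥) → Meets v (restrict y c)
  meets-restrict y v (false ∷ A , B) meets avoid z = trans (sym (hits-∷ y v false A z)) (meets z)
  meets-restrict y v (true ∷ A , B) meets avoid z with z ≟ᶠ y
  ... | yes refl = trans (no-preimage⇒¬hits v A z avoid) (sym (∧-zeroʳ (B z)))
  ... | no z≢y = begin
    hits v A z                          ≡⟨ cong (_∨ hits v A z) (sym (dec-false (y ≟ᶠ z) (λ e → z≢y (sym e)))) ⟩
    does (y ≟ᶠ z) ∨ hits v A z          ≡⟨ sym (hits-∷ y v true A z) ⟩
    hits (y ∷ v) (true ∷ A) z           ≡⟨ meets z ⟩
    B z                                 ≡⟨ sym (∧-identityʳ (B z)) ⟩
    B z ∧ true                          ∎
    where open ≡-Reasoning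

  admissible-∷ : ∀ {s t} (F : Fin t → Bool) (Cs : List (Constraint (suc s) t)) (y : Fin t) (v : Vec (Fin t) s) →
    Admissible F Cs (y ∷ v) → FirstValue F Cs y × Admissible (forbid F y) (map (restrict y) Cs) v
  admissible-∷ F Cs y v (inj , avoidF , meets) =
    (avoidF zero , heads Cs meets) , injective-tail inj , avoidF′ , restricts Cs meets
    where
    avoid : ∀ i → lookup v i ≡ y → ⊥
    avoid = injective-head inj
    avoidF′ : ∀ i → forbid F y (lookup v i) ≡ false
    avoidF′ i rewrite dec-false (lookup v i ≟ᶠ y) (avoid i) = avoidF (suc i)
    heads : ∀ Cs → All (Meets (y ∷ v)) Cs → All (λ c → proj₂ c y ≡ srcHead c) Cs
    heads [] [] = []
    heads (c ∷ Cs) (m ∷ ms) = meets-head y v c m avoid ∷ heads Cs ms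
    restricts : ∀ Cs → All (Meets (y ∷ v)) Cs → All (Meets v) (map (restrict y) Cs)
    restricts [] [] = []
    restricts (c ∷ Cs) (m ∷ ms) = meets-restrict y v c m avoid ∷ restricts Cs ms

  restrict-source : ∀ {s t} (y : Fin t) (c : Constraint (suc s) t) → proj₁ (restrict y c) ≡ srcTail c
  restrict-source y (x ∷ A , B) = refl

  sourcesDisjoint-restrict : ∀ {s t} (y : Fin t) (Cs : List (Constraint (suc s) t)) →
    SourcesDisjoint Cs → SourcesDisjoint (map (restrict y) Cs)
  sourcesDisjoint-restrict y Cs h i = ≤-trans (≤-reflexive (trans (∑ˡ-map _ (restrict y) Cs)
    (∑ˡ-cong _ _ Cs (λ c → cong (λ A → bit (lookup A i)) (restrict-source y c)))))
    (≤-trans (≤-reflexive (∑ˡ-cong _ _ Cs (λ { (x ∷ A , B) → refl }))) (h (suc i)))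

  sizesMatch-restrict : ∀ {s t} (y : Fin t) (Cs : List (Constraint (suc s) t)) → SizesMatch Cs →
    All (λ c → proj₂ c y ≡ srcHead c) Cs → SizesMatch (map (restrict y) Cs)
  sizesMatch-restrict y [] [] [] = []
  sizesMatch-restrict y ((true ∷ A , B) ∷ Cs) (e ∷ es) (b ∷ bs) = suc-injective (trans e (#-remove B y b)) ∷ sizesMatch-restrict y Cs es bs
  sizesMatch-restrict y ((false ∷ A , B) ∷ Cs) (e ∷ es) (b ∷ bs) = e ∷ sizesMatch-restrict y Cs es bs

  targetsDisjoint-restrict : ∀ {s t} (F : Fin t → Bool) (y : Fin t) (Cs : List (Constraint (suc s) t)) →
    TargetsDisjoint F Cs → All (λ c → proj₂ c y ≡ srcHead c) Cs → TargetsDisjoint (forbid F y) (map (restrict y) Cs)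
  targetsDisjoint-restrict F y Cs h heads z with z ≟ᶠ y
  ... | yes refl = ≤-reflexive (cong suc (trans (∑ˡ-map _ (restrict z) Cs) (∑ˡ-zero _ Cs (removed Cs heads))))
    where
    -- the new forbidden point z = y lies in no restricted target
    removed : ∀ Cs → All (λ c → proj₂ c z ≡ srcHead c) Cs → All (λ c → bit (proj₂ (restrict z c) z) ≡ 0) Cs
    removed [] [] = []
    removed ((true ∷ A , B) ∷ Cs) (_ ∷ bs) =
      trans (cong (λ w → bit (B z ∧ not w)) (≟-refl z)) (cong bit (∧-zeroʳ (B z))) ∷ removed Cs bs
    removed ((false ∷ A , B) ∷ Cs) (b ∷ bs) = cong bit b ∷ removed Cs bs
  ... | no z≢y = ≤-trans (≤-reflexive (cong (bit (F z) +_) (trans (∑ˡ-map _ (restrict y) Cs) (∑ˡ-cong _ _ Cs unchanged)))) (h z)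
    where
    unchanged : ∀ c → bit (proj₂ (restrict y c) z) ≡ bit (proj₂ c z)
    unchanged (false ∷ A , B) = refl
    unchanged (true ∷ A , B) =
      trans (cong (λ w → bit (B z ∧ not w)) (dec-false (z ≟ᶠ y) z≢y)) (cong bit (∧-identityʳ (B z)))

  firstInSources : ∀ {s t} → List (Constraint (suc s) t) → ℕ
  firstInSources = ∑ˡ (λ c → bit (srcHead c))

  tailTotal : ∀ {s t} → List (Constraint (suc s) t) → ℕ
  tailTotal = ∑ˡ (λ c → ∣ srcTail c ∣)

  tailArrangements : ∀ {s t} → List (Constraint (suc s) t) → ℕ
  tailArrangements = ∏ˡ (λ c → ∣ srcTail c ∣ !)

  -- |A|! = |A ∖ {first point}|! · (|A| if the first point is in A, else 1)
  headFactor : ∀ {s t} → Constraint (suc s) t → ℕ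
  headFactor c = if srcHead c then ∣ proj₁ c ∣ else 1

  total-split : ∀ {s t} (Cs : List (Constraint (suc s) t)) → total Cs ≡ tailTotal Cs + firstInSources Cs
  total-split Cs = trans (∑ˡ-cong _ _ Cs pw) (∑ˡ-+ (λ c → ∣ srcTail c ∣) (λ c → bit (srcHead c)) Cs)
    where
    pw : ∀ c → ∣ proj₁ c ∣ ≡ ∣ srcTail c ∣ + bit (srcHead c)
    pw (true ∷ A , B) = +-comm 1 ∣ A ∣
    pw (false ∷ A , B) = sym (+-identityʳ ∣ A ∣)

  arrangements-split : ∀ {s t} (Cs : List (Constraint (suc s) t)) →
    arrangements Cs ≡ tailArrangements Cs * ∏ˡ headFactor Cs
  arrangements-split Cs = trans (∏ˡ-cong _ _ Cs pw) (∏ˡ-* (λ c → ∣ srcTail c ∣ !) headFactor Cs)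
    where
    pw : ∀ c → ∣ proj₁ c ∣ ! ≡ ∣ srcTail c ∣ ! * headFactor c
    pw (true ∷ A , B) = *-comm (suc ∣ A ∣) (∣ A ∣ !)
    pw (false ∷ A , B) = sym (*-identityʳ (∣ A ∣ !))

  total-restrict : ∀ {s t} (y : Fin t) (Cs : List (Constraint (suc s) t)) → total (map (restrict y) Cs) ≡ tailTotal Cs
  total-restrict y Cs = trans (∑ˡ-map _ (restrict y) Cs) (∑ˡ-cong _ _ Cs (λ c → cong ∣_∣ (restrict-source y c)))

  arrangements-restrict : ∀ {s t} (y : Fin t) (Cs : List (Constraint (suc s) t)) →
    arrangements (map (restrict y) Cs) ≡ tailArrangements Cs
  arrangements-restrict y Cs = trans (∏ˡ-map _ (restrict y) Cs) (∏ˡ-cong _ _ Cs (λ c → cong (λ A → ∣ A ∣ !) (restrict-source y c)))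

  tailTotal≤ : ∀ {s t} (Cs : List (Constraint (suc s) t)) → SourcesDisjoint Cs → tailTotal Cs ≤ s
  tailTotal≤ {s} Cs h = begin
    tailTotal Cs                                          ≡⟨ ∑ˡ-cong _ _ Cs (λ c → ∣∣≡# (srcTail c)) ⟩
    ∑ˡ (λ c → sum (λ i → bit (lookup (srcTail c) i))) Cs ≡⟨ ∑ˡ-sum-swap (λ c i → bit (lookup (srcTail c) i)) Cs ⟩
    sum (λ i → ∑ˡ (λ c → bit (lookup (srcTail c) i)) Cs) ≤⟨ sum-mono _ _ (λ i → ≤-trans (≤-reflexive (∑ˡ-cong _ _ Cs (tail-lookup i))) (h (suc i))) ⟩
    sum {s} (λ _ → 1)                                     ≡⟨ sum-one s ⟩
    s                                                     ∎
    where
    open ≤-Reasoning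
    tail-lookup : ∀ i c → bit (lookup (srcTail c) i) ≡ bit (lookup (proj₁ c) (suc i))
    tail-lookup i (x ∷ A , B) = refl

  firstInSources≤1 : ∀ {s t} (Cs : List (Constraint (suc s) t)) → SourcesDisjoint Cs → firstInSources Cs ≤ 1
  firstInSources≤1 Cs h = ≤-trans (≤-reflexive (∑ˡ-cong _ _ Cs (λ { (x ∷ A , B) → refl }))) (h zero)

  headFactors≡1 : ∀ {s t} (Cs : List (Constraint (suc s) t)) → firstInSources Cs ≡ 0 → ∏ˡ headFactor Cs ≡ 1
  headFactors≡1 [] _ = refl
  headFactors≡1 ((false ∷ A , B) ∷ Cs) e = trans (+-identityʳ _) (headFactors≡1 Cs e)

  firstValues : ∀ {s t} → (Fin t → Bool) → List (Constraint (suc s) t) → ℕ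
  firstValues F Cs = sum (λ y → ind (FirstValue? F Cs y))

  firstValues-free : ∀ {s t} (F : Fin t → Bool) (Cs : List (Constraint (suc s) t)) → firstInSources Cs ≡ 0 →
    SizesMatch Cs → TargetsDisjoint F Cs → firstValues F Cs ≤ t ∸ # F ∸ total Cs
  firstValues-free {s} {t} F Cs none sizes disjoint =
    ≤-trans (m+n≤o⇒m≤o∸n _ partition) (≤-reflexive (sym (∸-+-assoc t (# F) (total Cs))))
    where
    occupied : Fin t → ℕ
    occupied y = bit (F y) + ∑ˡ (λ c → bit (proj₂ c y)) Cs
    heads-false : ∀ Cs → firstInSources Cs ≡ 0 → All (λ c → srcHead c ≡ false) Cs
    heads-false [] _ = []
    heads-false ((false ∷ A , B) ∷ Cs) e = refl ∷ heads-false Cs e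
    outside-targets : ∀ y Cs → All (λ c → srcHead c ≡ false) Cs → All (λ c → proj₂ c y ≡ srcHead c) Cs →
      All (λ c → bit (proj₂ c y) ≡ 0) Cs
    outside-targets y [] [] [] = []
    outside-targets y (c ∷ Cs) (f ∷ fs) (b ∷ bs) = cong bit (trans b f) ∷ outside-targets y Cs fs bs
    -- each point is a first value, forbidden, or in a target -- at most one of these
    exclusive : ∀ y → ind (FirstValue? F Cs y) + occupied y ≤ 1
    exclusive y = by-cases (FirstValue? F Cs y)
      where
      by-cases : (d : Dec (FirstValue F Cs y)) → ind d + occupied y ≤ 1
      by-cases (yes (Fy , bs)) rewrite Fy | ∑ˡ-zero _ Cs (outside-targets y Cs (heads-false Cs none) bs) = ≤-refl
      by-cases (no _) = disjoint y
    occupied-total : sum occupied ≡ # F + total Cs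
    occupied-total = begin-equality
      sum occupied ≡⟨ ∑-distrib-+ (λ y → bit (F y)) (λ y → ∑ˡ (λ c → bit (proj₂ c y)) Cs) ⟩
      # F + sum (λ y → ∑ˡ (λ c → bit (proj₂ c y)) Cs) ≡⟨ cong (# F +_) (sym (∑ˡ-sum-swap (λ c y → bit (proj₂ c y)) Cs)) ⟩
      # F + ∑ˡ (λ c → # proj₂ c) Cs ≡⟨ cong (# F +_) (sym (∑ˡ-cong-All _ _ Cs sizes)) ⟩
      # F + total Cs ∎
      where open ≤-Reasoning
    partition : firstValues F Cs + (# F + total Cs) ≤ t
    partition = begin
      firstValues F Cs + (# F + total Cs)            ≡⟨ cong (firstValues F Cs +_) (sym occupied-total) ⟩
      firstValues F Cs + sum occupied                ≡⟨ sym (∑-distrib-+ (λ y → ind (FirstValue? F Cs y)) occupied) ⟩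
      sum (λ y → ind (FirstValue? F Cs y) + occupied y) ≤⟨ sum-mono _ _ exclusive ⟩
      sum {t} (λ _ → 1)                              ≡⟨ sum-one t ⟩
      t                                              ∎
      where open ≤-Reasoning

  -- If the first point lies in a source A with target B, a first value lies in B.
  firstValues-in-source : ∀ {s t} (F : Fin t → Bool) (Cs : List (Constraint (suc s) t)) → 1 ≤ firstInSources Cs →
    SizesMatch Cs → firstValues F Cs ≤ ∏ˡ headFactor Cs
  firstValues-in-source F Cs one sizes =
    ≤-trans (sum-mono _ _ (λ y → ind-mono (FirstValue? F Cs y) (heads? y Cs) proj₂)) (matching Cs one sizes)
    where
    heads? : ∀ y Cs → Dec (All (λ c → proj₂ c y ≡ srcHead c) Cs)
    heads? y Cs = All.all? (λ c → proj₂ c y ≟ᵇ srcHead c) Cs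
    matching : ∀ Cs → 1 ≤ firstInSources Cs → SizesMatch Cs → sum (λ y → ind (heads? y Cs)) ≤ ∏ˡ headFactor Cs
    matching ((true ∷ A , B) ∷ Cs) _ (e ∷ _) = begin
      sum (λ y → ind (heads? y ((true ∷ A , B) ∷ Cs))) ≤⟨ sum-mono _ _ (λ y → ind-mono (heads? y ((true ∷ A , B) ∷ Cs)) (B y ≟ᵇ true) All.head) ⟩
      sum (λ y → ind (B y ≟ᵇ true))                   ≡⟨ sum-cong-≗ (λ y → ind-true (B y)) ⟩
      # B                                              ≡⟨ sym e ⟩
      suc ∣ A ∣                                        ≤⟨ m≤m*n (suc ∣ A ∣) (∏ˡ headFactor Cs) {{>-nonZero (∏ˡ-pos headFactor Cs headFactor-pos)}} ⟩
      suc ∣ A ∣ * ∏ˡ headFactor Cs                     ∎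
      where
      open ≤-Reasoning
      ind-true : ∀ b → ind (b ≟ᵇ true) ≡ bit b
      ind-true true = refl
      ind-true false = refl
      headFactor-pos : ∀ c → 1 ≤ headFactor c
      headFactor-pos (true ∷ A , B) = s≤s z≤n
      headFactor-pos (false ∷ A , B) = ≤-refl
    matching ((false ∷ A , B) ∷ Cs) one (_ ∷ es) = begin
      sum (λ y → ind (heads? y ((false ∷ A , B) ∷ Cs))) ≤⟨ sum-mono _ _ (λ y → ind-mono (heads? y ((false ∷ A , B) ∷ Cs)) (heads? y Cs) All.tail) ⟩
      sum (λ y → ind (heads? y Cs))                    ≤⟨ matching Cs one es ⟩
      ∏ˡ headFactor Cs                                 ≡⟨ sym (+-identityʳ _) ⟩
      1 * ∏ˡ headFactor Cs                             ∎
      where open ≤-Reasoning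

  tailBound : ∀ {s t} → (Fin t → Bool) → List (Constraint (suc s) t) → ℕ
  tailBound {s} {t} F Cs = tailArrangements Cs * fall (t ∸ suc (# F) ∸ tailTotal Cs) (s ∸ tailTotal Cs)

  choices-free : ∀ {s t} (F : Fin t → Bool) (Cs : List (Constraint (suc s) t)) → firstInSources Cs ≡ 0 →
    SourcesDisjoint Cs → SizesMatch Cs → TargetsDisjoint F Cs →
    firstValues F Cs * tailBound F Cs ≤ arrangements Cs * fall (t ∸ # F ∸ total Cs) (suc s ∸ total Cs)
  choices-free {s} {t} F Cs none sources sizes targets = begin
    firstValues F Cs * (Φ′ * fall (t ∸ suc u ∸ D′) (s ∸ D′)) ≤⟨ *-monoˡ-≤ _ (firstValues-free F Cs none sizes targets) ⟩
    (t ∸ u ∸ total Cs) * (Φ′ * fall (t ∸ suc u ∸ D′) (s ∸ D′)) ≡⟨ cong (λ w → (t ∸ u ∸ w) * (Φ′ * fall (t ∸ suc u ∸ D′) (s ∸ D′))) D≡D′ ⟩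
    (t ∸ u ∸ D′) * (Φ′ * fall (t ∸ suc u ∸ D′) (s ∸ D′)) ≡⟨ x*[y*z]≡y*[x*z] (t ∸ u ∸ D′) Φ′ _ ⟩
    Φ′ * ((t ∸ u ∸ D′) * fall (t ∸ suc u ∸ D′) (s ∸ D′)) ≡⟨ cong (λ w → Φ′ * ((t ∸ u ∸ D′) * fall w (s ∸ D′))) shift ⟩
    Φ′ * fall (t ∸ u ∸ D′) (suc (s ∸ D′)) ≡⟨ cong₂ (λ a b → a * fall (t ∸ u ∸ D′) b) (sym Φ≡Φ′) (sym (+-∸-assoc 1 (tailTotal≤ Cs sources))) ⟩
    arrangements Cs * fall (t ∸ u ∸ D′) (suc s ∸ D′) ≡⟨ cong (λ w → arrangements Cs * fall (t ∸ u ∸ w) (suc s ∸ w)) (sym D≡D′) ⟩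
    arrangements Cs * fall (t ∸ u ∸ total Cs) (suc s ∸ total Cs) ∎
    where
    open ≤-Reasoning
    u = # F
    D′ = tailTotal Cs
    Φ′ = tailArrangements Cs
    D≡D′ : total Cs ≡ D′
    D≡D′ = trans (total-split Cs) (trans (cong (D′ +_) none) (+-identityʳ D′))
    Φ≡Φ′ : arrangements Cs ≡ Φ′
    Φ≡Φ′ = trans (arrangements-split Cs) (trans (cong (Φ′ *_) (headFactors≡1 Cs none)) (*-identityʳ Φ′))
    shift : t ∸ suc u ∸ D′ ≡ t ∸ u ∸ D′ ∸ 1
    shift = begin-equality
      t ∸ suc u ∸ D′ ≡⟨ ∸-+-assoc t (suc u) D′ ⟩
      t ∸ (suc u + D′) ≡⟨ cong (t ∸_) (+-comm 1 (u + D′)) ⟩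
      t ∸ (u + D′ + 1) ≡⟨ sym (∸-+-assoc t (u + D′) 1) ⟩
      t ∸ (u + D′) ∸ 1 ≡⟨ cong (_∸ 1) (sym (∸-+-assoc t u D′)) ⟩
      t ∸ u ∸ D′ ∸ 1 ∎

  choices-in-source : ∀ {s t} (F : Fin t → Bool) (Cs : List (Constraint (suc s) t)) → firstInSources Cs ≡ 1 →
    SizesMatch Cs →
    firstValues F Cs * tailBound F Cs ≤ arrangements Cs * fall (t ∸ # F ∸ total Cs) (suc s ∸ total Cs)
  choices-in-source {s} {t} F Cs one sizes = begin
    firstValues F Cs * (Φ′ * fall (t ∸ suc u ∸ D′) (s ∸ D′)) ≤⟨ *-monoˡ-≤ _ (firstValues-in-source F Cs (≤-reflexive (sym one)) sizes) ⟩
    h * (Φ′ * fall (t ∸ suc u ∸ D′) (s ∸ D′)) ≡⟨ x*[y*z]≡y*[x*z] h Φ′ _ ⟩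
    Φ′ * (h * fall (t ∸ suc u ∸ D′) (s ∸ D′)) ≡⟨ sym (*-assoc Φ′ h _) ⟩
    Φ′ * h * fall (t ∸ suc u ∸ D′) (s ∸ D′) ≡⟨ cong₂ (λ a b → a * fall b (s ∸ D′)) (sym (arrangements-split Cs)) shift ⟩
    arrangements Cs * fall (t ∸ u ∸ suc D′) (suc s ∸ suc D′) ≡⟨ cong (λ w → arrangements Cs * fall (t ∸ u ∸ w) (suc s ∸ w)) (sym D≡1+D′) ⟩
    arrangements Cs * fall (t ∸ u ∸ total Cs) (suc s ∸ total Cs) ∎
    where
    open ≤-Reasoning
    u = # F
    h = ∏ˡ headFactor Cs
    D′ = tailTotal Cs
    Φ′ = tailArrangements Cs
    D≡1+D′ : total Cs ≡ suc D′
    D≡1+D′ = trans (total-split Cs) (trans (cong (D′ +_) one) (+-comm D′ 1))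
    shift : t ∸ suc u ∸ D′ ≡ t ∸ u ∸ suc D′
    shift = trans (∸-+-assoc t (suc u) D′) (trans (cong (t ∸_) (sym (+-suc u D′))) (sym (∸-+-assoc t u (suc D′))))

  count-by-first-value : ∀ {s t} (F : Fin t → Bool) (Cs : List (Constraint (suc s) t)) (R : ℕ) →
    (∀ y → FirstValue F Cs y → count (Admissible? (forbid F y) (map (restrict y) Cs)) ≤ R) →
    count (Admissible? F Cs) ≤ firstValues F Cs * R
  count-by-first-value {s} {t} F Cs R rest = begin
    count (Admissible? F Cs)                                        ≡⟨ ∑ˡ-allFuns-suc s t _ ⟩
    sum (λ y → ∑ˡ (λ v → ind (Admissible? F Cs (y ∷ v))) (allFuns s t)) ≤⟨ sum-mono _ _ (λ y → ∑ˡ-mono _ _ (allFuns s t) (split y)) ⟩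
    sum (λ y → ∑ˡ (λ v → ind (FirstValue? F Cs y) * ind (Admissible? (F′ y) (Cs′ y) v)) (allFuns s t))
      ≡⟨ sum-cong-≗ (λ y → ∑ˡ-*ˡ (ind (FirstValue? F Cs y)) _ (allFuns s t)) ⟩
    sum (λ y → ind (FirstValue? F Cs y) * count (Admissible? (F′ y) (Cs′ y))) ≤⟨ sum-mono _ _ (λ y → bound y (FirstValue? F Cs y)) ⟩
    sum (λ y → ind (FirstValue? F Cs y) * R)                        ≡⟨ sum-*ʳ (λ y → ind (FirstValue? F Cs y)) R ⟩
    firstValues F Cs * R                                            ∎
    where
    open ≤-Reasoning
    F′ = forbid F
    Cs′ = λ y → map (restrict y) Cs
    split : ∀ y v → ind (Admissible? F Cs (y ∷ v)) ≤ ind (FirstValue? F Cs y) * ind (Admissible? (F′ y) (Cs′ y) v)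
    split y v = ≤-trans (ind-mono (Admissible? F Cs (y ∷ v)) (FirstValue? F Cs y ×-dec Admissible? (F′ y) (Cs′ y) v) (admissible-∷ F Cs y v))
                        (≤-reflexive (ind-× (FirstValue? F Cs y) (Admissible? (F′ y) (Cs′ y) v)))
    bound : ∀ y (d : Dec (FirstValue F Cs y)) → ind d * count (Admissible? (F′ y) (Cs′ y)) ≤ ind d * R
    bound y (no _) = z≤n
    bound y (yes first) = *-monoʳ-≤ 1 (rest y first)

  fiber-bound : ∀ s {t} (F : Fin t → Bool) (Cs : List (Constraint s t)) →
    SourcesDisjoint Cs → SizesMatch Cs → TargetsDisjoint F Cs →
    count (Admissible? F Cs) ≤ arrangements Cs * fall (t ∸ # F ∸ total Cs) (s ∸ total Cs)
  fiber-bound zero F Cs _ _ _ rewrite 0∸n≡0 (total Cs) | *-identityʳ (arrangements Cs) =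
    ≤-trans (≤-reflexive (+-identityʳ _))
      (≤-trans (ind≤1 (Admissible? F Cs [])) (∏ˡ-pos (λ c → ∣ proj₁ c ∣ !) Cs (λ c → 1≤n! ∣ proj₁ c ∣)))
  fiber-bound (suc s) {t} F Cs sources sizes targets =
    ≤-trans (count-by-first-value F Cs (tailBound F Cs) rest) (choices (n≤1⇒n≡0∨n≡1 (firstInSources≤1 Cs sources)))
    where
    rest : ∀ y → FirstValue F Cs y → count (Admissible? (forbid F y) (map (restrict y) Cs)) ≤ tailBound F Cs
    rest y (Fy , heads) rewrite sym (arrangements-restrict y Cs) | sym (total-restrict y Cs) | sym (#-forbid F y Fy) =
      fiber-bound s (forbid F y) (map (restrict y) Cs) (sourcesDisjoint-restrict y Cs sources)
        (sizesMatch-restrict y Cs sizes heads) (targetsDisjoint-restrict F y Cs targets heads)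
    choices : firstInSources Cs ≡ 0 ⊎ firstInSources Cs ≡ 1 →
      firstValues F Cs * tailBound F Cs ≤ arrangements Cs * fall (t ∸ # F ∸ total Cs) (suc s ∸ total Cs)
    choices (inj₁ none) = choices-free F Cs none sources sizes targets
    choices (inj₂ one) = choices-in-source F Cs one sizes

module InjectionCount where

  open import Defs
  open Sums
  open Images
  open FiberBound
  open import Data.Nat using (ℕ; zero; suc; _+_; _*_; _∸_; _≤_; z≤n)
  open import Data.Nat.Properties
  open import Data.Bool using (Bool; true; false; _∨_)
  open import Data.Bool.Properties using () renaming (_≟_ to _≟ᵇ_)
  open import Data.Fin using (Fin; zero; suc) renaming (_≟_ to _≟ᶠ_)
  open import Data.Vec using (Vec; []; _∷_; lookup)
  open import Data.List using ([]; length)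
  open import Data.List.Relation.Unary.All using ([])
  open import Data.Product using (_,_; proj₁)
  open import Data.Empty using (⊥)
  open import Relation.Nullary using (Dec; yes; no; _×-dec_)
  open import Relation.Binary.PropositionalEquality

  -- Conversely to the fiber bound, without constraints there are at least
  -- (t − |F|)(t − |F| − 1)⋯ (s factors) injective tables avoiding F: every
  -- admissible first value y extends every admissible table avoiding F ∪ {y}.

  admissible-extend : ∀ {s t} (F : Fin t → Bool) (y : Fin t) (v : Vec (Fin t) s) → F y ≡ false →
    Admissible (forbid F y) [] v → Admissible F [] (y ∷ v)
  admissible-extend F y v Fy (inj , avoid , []) = injective-∷ inj avoids-y , avoidF , []
    where
    avoids-y : ∀ i → lookup v i ≡ y → ⊥
    avoids-y i e with trans (sym (cong (forbid F y) e)) (avoid i)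
    ... | y-allowed rewrite ≟-refl y with y-allowed
    ... | ()
    ∨-false : ∀ a b → a ∨ b ≡ false → b ≡ false
    ∨-false false b e = e
    avoidF : ∀ i → F (lookup (y ∷ v) i) ≡ false
    avoidF zero = Fy
    avoidF (suc i) = ∨-false _ _ (avoid i)

  #-complement : ∀ {t} (F : Fin t → Bool) → sum (λ y → ind (F y ≟ᵇ false)) ≡ t ∸ # F
  #-complement {t} F = trans (sym (m+n∸n≡m _ (# F))) (cong (_∸ # F) partition)
    where
    pw : ∀ y → ind (F y ≟ᵇ false) + bit (F y) ≡ 1
    pw y with F y
    ... | true = refl
    ... | false = refl
    partition : sum (λ y → ind (F y ≟ᵇ false)) + # F ≡ t
    partition = trans (sym (∑-distrib-+ (λ y → ind (F y ≟ᵇ false)) (λ y → bit (F y)))) (trans (sum-cong-≗ pw) (sum-one t))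

  admissible-lower : ∀ s {t} (F : Fin t → Bool) → fall (t ∸ # F) s ≤ count (Admissible? {s} F [])
  admissible-lower zero F = ≤-trans (≤-reflexive (sym (ind-yes (Admissible? F [] []) ((λ ()) , (λ ()) , [])))) (≤-reflexive (sym (+-identityʳ _)))
  admissible-lower (suc s) {t} F = begin
    (t ∸ u) * fall (t ∸ u ∸ 1) s ≡⟨ cong₂ (λ a b → a * fall b s) (sym (#-complement F)) shift ⟩
    sum outside * fall (t ∸ suc u) s ≡⟨ sym (sum-*ʳ outside _) ⟩
    sum (λ y → outside y * fall (t ∸ suc u) s) ≤⟨ sum-mono _ _ (λ y → rest y (F y ≟ᵇ false)) ⟩
    sum (λ y → outside y * count (Admissible? {s} (forbid F y) [])) ≡⟨ sum-cong-≗ (λ y → sym (∑ˡ-*ˡ (outside y) _ (allFuns s t))) ⟩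
    sum (λ y → ∑ˡ (λ v → outside y * ind (Admissible? (forbid F y) [] v)) (allFuns s t))
      ≤⟨ sum-mono _ _ (λ y → ∑ˡ-mono _ _ (allFuns s t) (extend y)) ⟩
    sum (λ y → ∑ˡ (λ v → ind (Admissible? F [] (y ∷ v))) (allFuns s t)) ≡⟨ sym (∑ˡ-allFuns-suc s t _) ⟩
    count (Admissible? {suc s} F []) ∎
    where
    open ≤-Reasoning
    u = # F
    outside : Fin t → ℕ
    outside y = ind (F y ≟ᵇ false)
    shift : t ∸ u ∸ 1 ≡ t ∸ suc u
    shift = trans (∸-+-assoc t u 1) (cong (t ∸_) (+-comm u 1))
    rest : ∀ y → (d : Dec (F y ≡ false)) → ind d * fall (t ∸ suc u) s ≤ ind d * count (Admissible? {s} (forbid F y) [])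
    rest y (no _) = z≤n
    rest y (yes Fy) = *-monoʳ-≤ 1 (subst (λ w → fall (t ∸ w) s ≤ count (Admissible? {s} (forbid F y) [])) (#-forbid F y Fy) (admissible-lower s (forbid F y)))
    extend : ∀ y v → outside y * ind (Admissible? (forbid F y) [] v) ≤ ind (Admissible? F [] (y ∷ v))
    extend y v = ≤-trans (≤-reflexive (sym (ind-× (F y ≟ᵇ false) (Admissible? (forbid F y) [] v))))
      (ind-mono ((F y ≟ᵇ false) ×-dec Admissible? (forbid F y) [] v) (Admissible? F [] (y ∷ v)) (λ (Fy , adm) → admissible-extend F y v Fy adm))

  injections-lower : ∀ s t → fall t s ≤ length (allInjections s t)
  injections-lower s t = begin
    fall t s ≡⟨ cong (λ w → fall (t ∸ w) s) (sym (sum-zero t)) ⟩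
    fall (t ∸ # nothing {t}) s ≤⟨ admissible-lower s nothing ⟩
    count (Admissible? {s} (nothing {t}) []) ≤⟨ ∑ˡ-mono _ _ (allFuns s t) (λ v → ind-mono (Admissible? nothing [] v) (injective? v) proj₁) ⟩
    ∑ˡ (λ v → ind (injective? v)) (allFuns s t) ≡⟨ sym (length-filter-∑ˡ injective? (allFuns s t)) ⟩
    length (allInjections s t) ∎
    where open ≤-Reasoning

module Families where

  open import Defs
  open Sums
  open Images
  open FiberBound
  open InjectionCount
  open import Data.Nat using (ℕ; zero; suc; _+_; _*_; _∸_; _^_; _≤_; z≤n; _!)
  open import Data.Nat.Properties
  open import Data.Bool using (Bool; true; false)
  open import Data.Fin using (Fin; zero; suc)
  open import Data.Fin.Subset using (Subset; ∣_∣; _∩_; Empty)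
  open import Data.Fin.Subset.Properties using (x∈p∩q⁺; p∩q⊆p; p∩q⊆q; nonempty?)
  open import Data.Vec using (Vec; []; _∷_; lookup)
  open import Data.Vec.Properties using ([]=⇒lookup; lookup⇒[]=)
  open import Data.List using (List; []; _∷_; [_]; _++_; map; filter; length; zipWith; deduplicate; cartesianProductWith)
  open import Data.List.Properties using (length-++; length-map; filter-all)
  open import Data.List.Membership.Propositional using (_∈_)
  open import Data.List.Relation.Unary.All as All using (All; []; _∷_)
  import Data.List.Relation.Unary.All.Properties as All
  open import Data.List.Relation.Unary.Any as Any using (Any; here)
  import Data.List.Relation.Unary.Any.Properties as Any
  open import Data.List.Relation.Unary.AllPairs as AllPairs using (AllPairs; []; _∷_)
  import Data.List.Relation.Unary.AllPairs.Properties as AllPairs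
  open import Data.List.Relation.Binary.Sublist.Propositional using (_⊆_; []; _∷_; _∷ʳ_)
  open import Data.List.Relation.Binary.Sublist.Propositional.Properties using (All-resp-⊆)
  open import Data.Product using (∃; _×_; _,_; proj₁; proj₂)
  open import Data.Empty using (⊥-elim)
  open import Relation.Nullary using (Dec; yes; no; does; ¬_; ¬?; _×-dec_)
  open import Relation.Unary using (Decidable)
  open import Relation.Binary.PropositionalEquality hiding ([_])
  open import Algebra.Properties.CommutativeSemigroup *-commutativeSemigroup
    using () renaming (interchange to *-interchange)

  Disjoint : ∀ {n} → Subset n → Subset n → Set
  Disjoint A B = Empty (A ∩ B)

  Disjoint? : ∀ {n} (A B : Subset n) → Dec (Disjoint A B)
  Disjoint? A B = ¬? (nonempty? (A ∩ B))

  disjoint-lookup : ∀ {n} (A B : Subset n) (i : Fin n) → Disjoint A B → lookup A i ≡ true → lookup B i ≡ false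
  disjoint-lookup A B i d a with lookup B i in eb
  ... | false = refl
  ... | true = ⊥-elim (d (i , x∈p∩q⁺ (lookup⇒[]= i A a , lookup⇒[]= i B eb)))

  at-most-once : ∀ {n} (L : List (Subset n)) → AllPairs Disjoint L → ∀ i → ∑ˡ (λ A → bit (lookup A i)) L ≤ 1
  at-most-once [] [] i = z≤n
  at-most-once (A ∷ L) (ds ∷ dp) i with lookup A i in ea
  ... | false = at-most-once L dp i
  ... | true = ≤-reflexive (cong suc (∑ˡ-zero _ L (All.map (λ {B} d → cong bit (disjoint-lookup A B i d ea)) ds)))

  family-size≤ : ∀ {n} (L : List (Subset n)) → AllPairs Disjoint L → ∑ˡ ∣_∣ L ≤ n
  family-size≤ {n} L dp = begin
    ∑ˡ ∣_∣ L                                   ≡⟨ ∑ˡ-cong _ _ L ∣∣≡# ⟩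
    ∑ˡ (λ A → sum (λ i → bit (lookup A i))) L ≡⟨ ∑ˡ-sum-swap (λ A i → bit (lookup A i)) L ⟩
    sum (λ i → ∑ˡ (λ A → bit (lookup A i)) L) ≤⟨ sum-mono _ _ (at-most-once L dp) ⟩
    sum {n} (λ _ → 1)                          ≡⟨ sum-one n ⟩
    n                                          ∎
    where open ≤-Reasoning

  family-size : ∀ {n} Δ (L : List (Subset n)) → All (λ A → ∣ A ∣ ≡ Δ) L → ∑ˡ ∣_∣ L ≡ length L * Δ
  family-size Δ L sizes = trans (∑ˡ-cong-All _ _ L sizes) (∑ˡ-const Δ L)

  image-preimage : ∀ {s t} (f : Vec (Fin t) s) (A : Subset s) (z : Fin t) → lookup (image f A) z ≡ true →
    ∃ λ i → lookup A i ≡ true × lookup f i ≡ z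
  image-preimage f A z e = hits⇒preimage f A z (trans (sym (lookup-image f A z)) e)

  image-disjoint : ∀ {s t} (f : Vec (Fin t) s) → Injective f → ∀ {A B} → Disjoint A B → Disjoint (image f A) (image f B)
  image-disjoint f inj {A} {B} d (z , z∈)
    with image-preimage f A z ([]=⇒lookup (p∩q⊆p _ _ z∈)) | image-preimage f B z ([]=⇒lookup (p∩q⊆q _ _ z∈))
  ... | i , ai , fi | j , bj , fj with inj i j (trans fi (sym fj))
  ... | refl = d (i , x∈p∩q⁺ (lookup⇒[]= i A ai , lookup⇒[]= i B bj))

  images-disjoint : ∀ {s t} (f : Vec (Fin t) s) → Injective f → ∀ L → AllPairs Disjoint L →
    AllPairs Disjoint (map (image f) L)
  images-disjoint f inj L dp = AllPairs.map⁺ (AllPairs.map (image-disjoint f inj) dp)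

  element : ∀ {n} (A : Subset n) → 1 ≤ ∣ A ∣ → ∃ λ i → lookup A i ≡ true
  element (true ∷ A) _ = zero , refl
  element (false ∷ A) h with element A h
  ... | i , e = suc i , e

  image-≢ : ∀ {s t} (f : Vec (Fin t) s) → Injective f → ∀ A B → 1 ≤ ∣ A ∣ → Disjoint A B → image f A ≢ image f B
  image-≢ f inj A B nonempty d e with element A nonempty
  ... | i , ai = image-disjoint f inj d (lookup f i , x∈p∩q⁺ (lookup⇒[]= _ _ inA , lookup⇒[]= _ _ inB))
    where
    inA : lookup (image f A) (lookup f i) ≡ true
    inA = trans (lookup-image f A _) (preimage⇒hits f A i ai)
    inB : lookup (image f B) (lookup f i) ≡ true
    inB = trans (cong (λ X → lookup X (lookup f i)) (sym e)) inA

  images-distinct : ∀ {s t} (f : Vec (Fin t) s) → Injective f → ∀ Δ → 1 ≤ Δ → ∀ L → AllPairs Disjoint L →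
    All (λ A → ∣ A ∣ ≡ Δ) L → AllPairs (λ X Y → X ≢ Y) (map (image f) L)
  images-distinct f inj Δ Δ≥1 [] [] [] = []
  images-distinct f inj Δ Δ≥1 (A ∷ L) (ds ∷ dp) (size ∷ sizes) =
    All.map⁺ (All.map (λ {B} d → image-≢ f inj A B (≤-trans Δ≥1 (≤-reflexive (sym size))) d) ds)
    ∷ images-distinct f inj Δ Δ≥1 L dp sizes

  deduplicate-id : ∀ {a r} {A : Set a} {R : A → A → Set r} (R? : ∀ x y → Dec (R x y)) (xs : List A) →
    AllPairs (λ x y → ¬ R x y) xs → deduplicate R? xs ≡ xs
  deduplicate-id R? [] [] = refl
  deduplicate-id R? (x ∷ xs) (nx ∷ p) rewrite deduplicate-id R? xs p = cong (x ∷_) (filter-all (λ y → ¬? (R? x y)) nx)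

  module _ {a} {A : Set a} where

    tuples : List A → ℕ → List (List A)
    tuples xs zero = [ [] ]
    tuples xs (suc j) = cartesianProductWith _∷_ xs (tuples xs j)

    length-tuples : ∀ xs j → length (tuples xs j) ≡ length xs ^ j
    length-tuples xs zero = refl
    length-tuples xs (suc j) = trans (length-product xs (tuples xs j)) (cong (length xs *_) (length-tuples xs j))
      where
      length-product : ∀ ys zss → length (cartesianProductWith _∷_ ys zss) ≡ length ys * length zss
      length-product [] zss = refl
      length-product (y ∷ ys) zss = trans (length-++ (map (y ∷_) zss)) (cong₂ _+_ (length-map (y ∷_) zss) (length-product ys zss))

    tuples-complete : ∀ xs ys → All (_∈ xs) ys → ys ∈ tuples xs (length ys)
    tuples-complete xs [] [] = here refl
    tuples-complete xs (y ∷ ys) (p ∷ ps) = Any.cartesianProductWith⁺ _∷_ (cong₂ _∷_) p (tuples-complete xs ys ps)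

    tuples-sound : ∀ {p} {P : A → Set p} xs → All P xs → ∀ j → All (λ T → length T ≡ j × All P T) (tuples xs j)
    tuples-sound xs ps zero = (refl , []) ∷ []
    tuples-sound {P = P} xs ps (suc j) = product ps (tuples-sound xs ps j)
      where
      product : ∀ {ys zss} → All P ys → All (λ T → length T ≡ j × All P T) zss →
        All (λ T → length T ≡ suc j × All P T) (cartesianProductWith _∷_ ys zss)
      product [] qs = []
      product (p ∷ ps) qs = All.++⁺ (All.map⁺ (All.map (λ (l , q) → cong suc l , p ∷ q) qs)) (product ps qs)

    sublists : List A → List (List A)
    sublists [] = [ [] ]
    sublists (x ∷ xs) = map (x ∷_) (sublists xs) ++ sublists xs

    length-sublists : ∀ xs → length (sublists xs) ≡ 2 ^ length xs
    length-sublists [] = refl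
    length-sublists (x ∷ xs) = begin
      length (map (x ∷_) (sublists xs) ++ sublists xs)   ≡⟨ length-++ (map (x ∷_) (sublists xs)) ⟩
      length (map (x ∷_) (sublists xs)) + length (sublists xs) ≡⟨ cong (_+ length (sublists xs)) (length-map (x ∷_) (sublists xs)) ⟩
      length (sublists xs) + length (sublists xs)        ≡⟨ cong (λ w → w + w) (length-sublists xs) ⟩
      2 ^ length xs + 2 ^ length xs                      ≡⟨ cong (2 ^ length xs +_) (sym (+-identityʳ _)) ⟩
      2 ^ suc (length xs)                                ∎
      where open ≡-Reasoning

    sublists-sound : ∀ xs → All (_⊆ xs) (sublists xs)
    sublists-sound [] = [] ∷ []
    sublists-sound (x ∷ xs) = All.++⁺ (All.map⁺ (All.map (refl ∷_) (sublists-sound xs))) (All.map (x ∷ʳ_) (sublists-sound xs))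

    filter∈sublists : ∀ {p} {P : A → Set p} (P? : Decidable P) xs → filter P? xs ∈ sublists xs
    filter∈sublists P? [] = here refl
    filter∈sublists P? (x ∷ xs) with does (P? x)
    ... | true = Any.++⁺ˡ (Any.map⁺ (Any.map (cong (x ∷_)) (filter∈sublists P? xs)))
    ... | false = Any.++⁺ʳ (map (x ∷_) (sublists xs)) (filter∈sublists P? xs)

    AllPairs-resp-⊆ : ∀ {r} {R : A → A → Set r} {xs ys} → xs ⊆ ys → AllPairs R ys → AllPairs R xs
    AllPairs-resp-⊆ [] [] = []
    AllPairs-resp-⊆ (y ∷ʳ τ) (_ ∷ ps) = AllPairs-resp-⊆ τ ps
    AllPairs-resp-⊆ (refl ∷ τ) (p ∷ ps) = All-resp-⊆ τ p ∷ AllPairs-resp-⊆ τ ps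

  -- Each such f determines the tuple T = f(L) ∈ 𝒯^|L|, and then satisfies the
  -- constraints f(A_k) = T_k; the fiber bound counts those f for each T.

  module _ {s t : ℕ} (𝒯 : List (Subset t)) where

    MapsInto : Vec (Fin t) s → Subset s → Set
    MapsInto f A = image f A ∈ 𝒯

    MapsInto? : ∀ f A → Dec (MapsInto f A)
    MapsInto? f A = Any.any? (λ C → image f A ≟ˢ C) 𝒯

    countInto : List (Subset s) → ℕ
    countInto L = ∑ˡ (λ f → ind (All.all? (MapsInto? f) L)) (allInjections s t)

    constraints : List (Subset s) → List (Subset t) → List (Constraint s t)
    constraints = zipWith (λ A B → A , lookup B)

    constraints-sources : ∀ (g : Subset s → ℕ) L T → ∑ˡ (λ c → g (proj₁ c)) (constraints L T) ≤ ∑ˡ g L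
    constraints-sources g [] T = z≤n
    constraints-sources g (A ∷ L) [] = z≤n
    constraints-sources g (A ∷ L) (B ∷ T) = +-monoʳ-≤ (g A) (constraints-sources g L T)

    constraints-targets : ∀ (g : (Fin t → Bool) → ℕ) L T → ∑ˡ (λ c → g (proj₂ c)) (constraints L T) ≤ ∑ˡ (λ B → g (lookup B)) T
    constraints-targets g [] T = z≤n
    constraints-targets g (A ∷ L) [] = z≤n
    constraints-targets g (A ∷ L) (B ∷ T) = +-monoʳ-≤ (g (lookup B)) (constraints-targets g L T)

    constraints-total : ∀ L T → length T ≡ length L → total (constraints L T) ≡ ∑ˡ ∣_∣ L
    constraints-total [] [] e = refl
    constraints-total (A ∷ L) (B ∷ T) e = cong (∣ A ∣ +_) (constraints-total L T (suc-injective e))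

    constraints-arrangements : ∀ L T → length T ≡ length L → arrangements (constraints L T) ≡ ∏ˡ (λ A → ∣ A ∣ !) L
    constraints-arrangements [] [] e = refl
    constraints-arrangements (A ∷ L) (B ∷ T) e = cong (∣ A ∣ ! *_) (constraints-arrangements L T (suc-injective e))

    constraints-sizes : ∀ Δ L T → All (λ A → ∣ A ∣ ≡ Δ) L → All (λ B → ∣ B ∣ ≡ Δ) T → SizesMatch (constraints L T)
    constraints-sizes Δ [] T _ _ = []
    constraints-sizes Δ (A ∷ L) [] _ _ = []
    constraints-sizes Δ (A ∷ L) (B ∷ T) (a ∷ as) (b ∷ bs) = trans a (trans (sym b) (∣∣≡# B)) ∷ constraints-sizes Δ L T as bs

    image-tuple : ∀ L f → AllPairs Disjoint L → Injective f × All (MapsInto f) L →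
      Any (λ T → AllPairs Disjoint T × Admissible nothing (constraints L T) f) (tuples 𝒯 (length L))
    image-tuple L f dp (inj , into) = Any.map (λ { refl → images-disjoint f inj L dp , inj , (λ i → refl) , meets L })
      (subst (λ j → map (image f) L ∈ tuples 𝒯 j) (length-map (image f) L) (tuples-complete 𝒯 (map (image f) L) (All.map⁺ into)))
      where
      meets : ∀ L → All (Meets f) (constraints L (map (image f) L))
      meets [] = []
      meets (A ∷ L) = (λ z → sym (lookup-image f A z)) ∷ meets L

    tuple-bound : ∀ Δ L → AllPairs Disjoint L → All (λ A → ∣ A ∣ ≡ Δ) L → ∀ T → length T ≡ length L →
      All (λ B → ∣ B ∣ ≡ Δ) T → (d : Dec (AllPairs Disjoint T)) →
      ind d * count (Admissible? nothing (constraints L T)) ≤ (Δ !) ^ length L * fall (t ∸ length L * Δ) (s ∸ length L * Δ)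
    tuple-bound Δ L dpL sizesL T _ _ (no _) = z≤n
    tuple-bound Δ L dpL sizesL T lengths sizesT (yes dpT) = ≤-trans (≤-reflexive (+-identityʳ _))
      (subst (count (Admissible? nothing (constraints L T)) ≤_) bound≡
        (fiber-bound s nothing (constraints L T) sources (constraints-sizes Δ L T sizesL sizesT) targets))
      where
      sources : SourcesDisjoint (constraints L T)
      sources i = ≤-trans (constraints-sources (λ A → bit (lookup A i)) L T) (at-most-once L dpL i)
      targets : TargetsDisjoint nothing (constraints L T)
      targets z = ≤-trans (constraints-targets (λ B → bit (B z)) L T) (at-most-once T dpT z)
      D≡ : total (constraints L T) ≡ length L * Δ
      D≡ = trans (constraints-total L T lengths) (family-size Δ L sizesL)
      factorials : ∀ L → All (λ A → ∣ A ∣ ≡ Δ) L → ∏ˡ (λ A → ∣ A ∣ !) L ≡ (Δ !) ^ length L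
      factorials [] [] = refl
      factorials (A ∷ L) (a ∷ as) = cong₂ _*_ (cong _! a) (factorials L as)
      bound≡ : arrangements (constraints L T) * fall (t ∸ # nothing {t} ∸ total (constraints L T)) (s ∸ total (constraints L T))
             ≡ (Δ !) ^ length L * fall (t ∸ length L * Δ) (s ∸ length L * Δ)
      bound≡ = cong₂ _*_ (trans (constraints-arrangements L T lengths) (factorials L sizesL))
        (cong₂ fall (trans (cong (λ w → t ∸ w ∸ total (constraints L T)) (sum-zero t)) (cong (t ∸_) D≡)) (cong (s ∸_) D≡))

    -- at most |𝒯|^j tuples, each contributing at most (Δ!)^j (t − jΔ)⋯ injections (j = |L|)
    countInto-bound : ∀ Δ L → AllPairs Disjoint L → All (λ A → ∣ A ∣ ≡ Δ) L → All (λ B → ∣ B ∣ ≡ Δ) 𝒯 →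
      countInto L ≤ length 𝒯 ^ length L * ((Δ !) ^ length L * fall (t ∸ length L * Δ) (s ∸ length L * Δ))
    countInto-bound Δ L dpL sizesL sizes𝒯 = begin
      countInto L ≡⟨ ∑ˡ-filter injective? _ (allFuns s t) ⟩
      ∑ˡ (λ f → ind (injective? f) * ind (all-into f)) (allFuns s t)
        ≡⟨ ∑ˡ-cong _ _ (allFuns s t) (λ f → sym (ind-× (injective? f) (all-into f))) ⟩
      ∑ˡ (λ f → ind (injective? f ×-dec all-into f)) (allFuns s t)
        ≤⟨ ∑ˡ-mono _ _ (allFuns s t) (λ f → Any⇒ind≤∑ˡ (injective? f ×-dec all-into f) (Fits? f) (tuples 𝒯 j) (image-tuple L f dpL)) ⟩
      ∑ˡ (λ f → ∑ˡ (λ T → ind (Fits? f T)) (tuples 𝒯 j)) (allFuns s t)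
        ≡⟨ ∑ˡ-swap (λ f T → ind (Fits? f T)) (allFuns s t) (tuples 𝒯 j) ⟩
      ∑ˡ (λ T → ∑ˡ (λ f → ind (Fits? f T)) (allFuns s t)) (tuples 𝒯 j)
        ≡⟨ ∑ˡ-cong _ _ (tuples 𝒯 j) (λ T → trans (∑ˡ-cong _ _ (allFuns s t) (λ f → ind-× (disjoint? T) (Admissible? nothing (constraints L T) f)))
                                                 (∑ˡ-*ˡ (ind (disjoint? T)) _ (allFuns s t))) ⟩
      ∑ˡ (λ T → ind (disjoint? T) * count (Admissible? nothing (constraints L T))) (tuples 𝒯 j)
        ≤⟨ ∑ˡ-bound _ _ (tuples 𝒯 j) (All.map (λ {T} (l , sz) → tuple-bound Δ L dpL sizesL T l sz (disjoint? T)) (tuples-sound 𝒯 sizes𝒯 j)) ⟩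
      length (tuples 𝒯 j) * ((Δ !) ^ j * fall (t ∸ j * Δ) (s ∸ j * Δ)) ≡⟨ cong (_* ((Δ !) ^ j * fall (t ∸ j * Δ) (s ∸ j * Δ))) (length-tuples 𝒯 j) ⟩
      length 𝒯 ^ j * ((Δ !) ^ j * fall (t ∸ j * Δ) (s ∸ j * Δ)) ∎
      where
      open ≤-Reasoning
      j = length L
      all-into : ∀ f → Dec (All (MapsInto f) L)
      all-into f = All.all? (MapsInto? f) L
      disjoint? : ∀ T → Dec (AllPairs Disjoint T)
      disjoint? = AllPairs.allPairs? Disjoint?
      Fits? : ∀ f T → Dec (AllPairs Disjoint T × Admissible nothing (constraints L T) f)
      Fits? f T = disjoint? T ×-dec Admissible? nothing (constraints L T) f

    countInto-scaled : ∀ Δ L → AllPairs Disjoint L → All (λ A → ∣ A ∣ ≡ Δ) L → All (λ B → ∣ B ∣ ≡ Δ) 𝒯 →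
      ∀ b → b ≤ t ∸ length L * Δ →
      countInto L * b ^ (length L * Δ) ≤ (length 𝒯 * Δ !) ^ length L * length (allInjections s t)
    countInto-scaled Δ L dpL sizesL sizes𝒯 b b≤ = begin
      countInto L * b ^ D ≤⟨ *-monoʳ-≤ (countInto L) (≤-trans (^-monoˡ-≤ D b≤) (fall-lower t D)) ⟩
      countInto L * fall t D ≤⟨ *-monoˡ-≤ (fall t D) (countInto-bound Δ L dpL sizesL sizes𝒯) ⟩
      length 𝒯 ^ j * ((Δ !) ^ j * fall (t ∸ D) (s ∸ D)) * fall t D ≡⟨ regroup (length 𝒯 ^ j) ((Δ !) ^ j) (fall (t ∸ D) (s ∸ D)) (fall t D) ⟩
      length 𝒯 ^ j * (Δ !) ^ j * (fall t D * fall (t ∸ D) (s ∸ D)) ≡⟨ cong₂ _*_ (sym (*-^ (length 𝒯) (Δ !) j)) (sym (fall-+ t D (s ∸ D))) ⟩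
      (length 𝒯 * Δ !) ^ j * fall t (D + (s ∸ D)) ≡⟨ cong (λ w → (length 𝒯 * Δ !) ^ j * fall t w) (m+[n∸m]≡n D≤s) ⟩
      (length 𝒯 * Δ !) ^ j * fall t s ≤⟨ *-monoʳ-≤ ((length 𝒯 * Δ !) ^ j) (injections-lower s t) ⟩
      (length 𝒯 * Δ !) ^ j * length (allInjections s t) ∎
      where
      open ≤-Reasoning
      j = length L
      D = j * Δ
      D≤s : D ≤ s
      D≤s = ≤-trans (≤-reflexive (sym (family-size Δ L sizesL))) (family-size≤ L dpL)
      *-^ : ∀ m n k → (m * n) ^ k ≡ m ^ k * n ^ k
      *-^ m n zero = refl
      *-^ m n (suc k) rewrite *-^ m n k = *-interchange m n (m ^ k) (n ^ k)
      regroup : ∀ a b c d → a * (b * c) * d ≡ a * b * (d * c)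
      regroup a b c d = begin-equality
        a * (b * c) * d ≡⟨ cong (_* d) (sym (*-assoc a b c)) ⟩
        a * b * c * d ≡⟨ *-assoc (a * b) c d ⟩
        a * b * (c * d) ≡⟨ cong (a * b *_) (*-comm c d) ⟩
        a * b * (d * c) ∎

    -- For an injection and a disjoint family 𝒮 of nonempty sets, the images are
    -- distinct, so each set of 𝒮 is counted once: outside 𝒯 or inside it.
    outside+inside : ∀ Δ → 1 ≤ Δ → (𝒮 : List (Subset s)) → AllPairs Disjoint 𝒮 → All (λ A → ∣ A ∣ ≡ Δ) 𝒮 →
      ∀ f → Injective f → countImageOutside f 𝒮 𝒯 + length (filter (MapsInto? f) 𝒮) ≡ length 𝒮
    outside+inside Δ Δ≥1 𝒮 dp sizes f inj = begin
      countImageOutside f 𝒮 𝒯 + length (filter (MapsInto? f) 𝒮)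
        ≡⟨ cong₂ _+_ (cong (λ xs → length (outside xs)) (deduplicate-id _≟ˢ_ (map (image f) 𝒮) (images-distinct f inj Δ Δ≥1 𝒮 dp sizes)))
                     (length-filter-∑ˡ (MapsInto? f) 𝒮) ⟩
      length (outside (map (image f) 𝒮)) + ∑ˡ (λ A → ind (MapsInto? f A)) 𝒮
        ≡⟨ cong (_+ ∑ˡ (λ A → ind (MapsInto? f A)) 𝒮) (trans (length-filter-∑ˡ _ (map (image f) 𝒮)) (∑ˡ-map _ (image f) 𝒮)) ⟩
      ∑ˡ (λ A → ind (¬? (MapsInto? f A))) 𝒮 + ∑ˡ (λ A → ind (MapsInto? f A)) 𝒮
        ≡⟨ sym (∑ˡ-+ (λ A → ind (¬? (MapsInto? f A))) (λ A → ind (MapsInto? f A)) 𝒮) ⟩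
      ∑ˡ (λ A → ind (¬? (MapsInto? f A)) + ind (MapsInto? f A)) 𝒮
        ≡⟨ ∑ˡ-cong _ _ 𝒮 (λ A → trans (+-comm _ (ind (MapsInto? f A))) (ind-¬ (MapsInto? f A))) ⟩
      ∑ˡ (λ _ → 1) 𝒮 ≡⟨ trans (∑ˡ-const 1 𝒮) (*-identityʳ _) ⟩
      length 𝒮 ∎
      where
      open ≡-Reasoning
      outside : List (Subset t) → List (Subset t)
      outside = filter (λ B → ¬? (Any.any? (λ C → B ≟ˢ C) 𝒯))

    -- Union bound: an injection with property P is counted by the sublist of 𝒮
    -- it maps into 𝒯, provided that sublist has property Q.
    union-bound : ∀ (𝒮 : List (Subset s)) {P : Vec (Fin t) s → Set} (P? : Decidable P)
      {Q : List (Subset s) → Set} (Q? : Decidable Q) →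
      (∀ f → Injective f → P f → Q (filter (MapsInto? f) 𝒮)) →
      ∑ˡ (λ f → ind (P? f)) (allInjections s t) ≤ ∑ˡ (λ L → ind (Q? L) * countInto L) (sublists 𝒮)
    union-bound 𝒮 {P} P? {Q} Q? counted = begin
      ∑ˡ (λ f → ind (P? f)) (allInjections s t) ≡⟨ ∑ˡ-filter injective? _ (allFuns s t) ⟩
      ∑ˡ (λ f → ind (injective? f) * ind (P? f)) (allFuns s t) ≡⟨ ∑ˡ-cong _ _ (allFuns s t) (λ f → sym (ind-× (injective? f) (P? f))) ⟩
      ∑ˡ (λ f → ind (injective? f ×-dec P? f)) (allFuns s t)
        ≤⟨ ∑ˡ-mono _ _ (allFuns s t) (λ f → Any⇒ind≤∑ˡ (injective? f ×-dec P? f) (Counts? f) (sublists 𝒮) (witness f)) ⟩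
      ∑ˡ (λ f → ∑ˡ (λ L → ind (Counts? f L)) (sublists 𝒮)) (allFuns s t) ≡⟨ ∑ˡ-swap (λ f L → ind (Counts? f L)) (allFuns s t) (sublists 𝒮) ⟩
      ∑ˡ (λ L → ∑ˡ (λ f → ind (Counts? f L)) (allFuns s t)) (sublists 𝒮) ≡⟨ ∑ˡ-cong _ _ (sublists 𝒮) per-sublist ⟩
      ∑ˡ (λ L → ind (Q? L) * countInto L) (sublists 𝒮) ∎
      where
      open ≤-Reasoning
      Counts? : ∀ f L → Dec (Q L × (Injective f × All (MapsInto f) L))
      Counts? f L = Q? L ×-dec (injective? f ×-dec All.all? (MapsInto? f) L)
      witness : ∀ f → Injective f × P f → Any (λ L → Q L × (Injective f × All (MapsInto f) L)) (sublists 𝒮)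
      witness f (inj , p) = Any.map (λ { refl → counted f inj p , inj , All.all-filter (MapsInto? f) 𝒮 }) (filter∈sublists (MapsInto? f) 𝒮)
      per-sublist : ∀ L → ∑ˡ (λ f → ind (Counts? f L)) (allFuns s t) ≡ ind (Q? L) * countInto L
      per-sublist L = begin-equality
        ∑ˡ (λ f → ind (Counts? f L)) (allFuns s t)
          ≡⟨ ∑ˡ-cong _ _ (allFuns s t) (λ f → ind-× (Q? L) (injective? f ×-dec All.all? (MapsInto? f) L)) ⟩
        ∑ˡ (λ f → ind (Q? L) * ind (injective? f ×-dec All.all? (MapsInto? f) L)) (allFuns s t) ≡⟨ ∑ˡ-*ˡ (ind (Q? L)) _ (allFuns s t) ⟩
        ind (Q? L) * ∑ˡ (λ f → ind (injective? f ×-dec All.all? (MapsInto? f) L)) (allFuns s t)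
          ≡⟨ cong (ind (Q? L) *_) (trans (∑ˡ-cong _ _ (allFuns s t) (λ f → ind-× (injective? f) (All.all? (MapsInto? f) L)))
                                          (sym (∑ˡ-filter injective? _ (allFuns s t)))) ⟩
        ind (Q? L) * countInto L ∎

module RationalFacts where

  open import Defs
  open Sums using (∑ˡ)
  open import Data.Nat as ℕ using (ℕ; zero; suc)
  import Data.Nat.Properties as ℕ
  open import Data.Integer as ℤ using (+_; +[1+_])
  import Data.Integer.Properties as ℤ
  open import Data.Rational hiding (∣_∣)
  open import Data.Rational.Properties
  import Data.Rational.Unnormalised as ℚᵘ
  import Data.Rational.Unnormalised.Properties as ℚᵘ
  open import Data.Rational.Solver using (module +-*-Solver)
  open +-*-Solver using (solve; _:+_; _:*_; _:-_; _:=_; con)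
  import Data.Nat.Coprimality as Coprime
  open import Data.List using (List; []; _∷_; length)
  open import Data.List.Relation.Unary.All using (All; []; _∷_)
  open import Relation.Binary.PropositionalEquality

  ⟦⟧-normal : ∀ n → ⟦ n ⟧ ≡ mkℚ (+ n) 0 (Coprime.sym (Coprime.1-coprimeTo n))
  ⟦⟧-normal n = normalize-coprime (Coprime.sym (Coprime.1-coprimeTo n))

  ⟦+⟧ : ∀ a b → ⟦ a ℕ.+ b ⟧ ≡ ⟦ a ⟧ + ⟦ b ⟧
  ⟦+⟧ a b rewrite ⟦⟧-normal a | ⟦⟧-normal b = /-cong {p₁ = + (a ℕ.+ b)} {q₁ = 1} {q₂ = 1}
    (trans (ℤ.pos-+ a b) (sym (cong₂ ℤ._+_ (ℤ.*-identityʳ (+ a)) (ℤ.*-identityʳ (+ b))))) refl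

  ⟦*⟧ : ∀ a b → ⟦ a ℕ.* b ⟧ ≡ ⟦ a ⟧ * ⟦ b ⟧
  ⟦*⟧ a b rewrite ⟦⟧-normal a | ⟦⟧-normal b = /-cong {p₁ = + (a ℕ.* b)} {q₁ = 1} {q₂ = 1} (ℤ.pos-* a b) refl

  ⟦^⟧ : ∀ a k → ⟦ a ℕ.^ k ⟧ ≡ ⟦ a ⟧ ^ℚ k
  ⟦^⟧ a zero = refl
  ⟦^⟧ a (suc k) = trans (⟦*⟧ a (a ℕ.^ k)) (cong (⟦ a ⟧ *_) (⟦^⟧ a k))

  ⟦-⟧ : ∀ {a b} → b ℕ.≤ a → ⟦ a ℕ.∸ b ⟧ ≡ ⟦ a ⟧ - ⟦ b ⟧
  ⟦-⟧ {a} {b} b≤a = begin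
    ⟦ a ℕ.∸ b ⟧                   ≡⟨ solve 2 (λ x y → x := x :+ y :- y) refl ⟦ a ℕ.∸ b ⟧ ⟦ b ⟧ ⟩
    ⟦ a ℕ.∸ b ⟧ + ⟦ b ⟧ - ⟦ b ⟧   ≡⟨ cong (_- ⟦ b ⟧) (sym (⟦+⟧ (a ℕ.∸ b) b)) ⟩
    ⟦ a ℕ.∸ b ℕ.+ b ⟧ - ⟦ b ⟧     ≡⟨ cong (λ w → ⟦ w ⟧ - ⟦ b ⟧) (ℕ.m∸n+n≡m b≤a) ⟩
    ⟦ a ⟧ - ⟦ b ⟧                 ∎
    where open ≡-Reasoning

  ⟦≤⟧ : ∀ {a b} → a ℕ.≤ b → ⟦ a ⟧ ≤ ⟦ b ⟧
  ⟦≤⟧ {a} {b} h rewrite ⟦⟧-normal a | ⟦⟧-normal b =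
    *≤* (subst₂ ℤ._≤_ (sym (ℤ.*-identityʳ (+ a))) (sym (ℤ.*-identityʳ (+ b))) (ℤ.+≤+ h))

  ⟦≤⟧⁻¹ : ∀ {a b} → ⟦ a ⟧ ≤ ⟦ b ⟧ → a ℕ.≤ b
  ⟦≤⟧⁻¹ {a} {b} h rewrite ⟦⟧-normal a | ⟦⟧-normal b with h
  ... | *≤* h′ = ℤ.drop‿+≤+ (subst₂ ℤ._≤_ (ℤ.*-identityʳ (+ a)) (ℤ.*-identityʳ (+ b)) h′)

  0≤⟦⟧ : ∀ a → 0ℚ ≤ ⟦ a ⟧
  0≤⟦⟧ a = ⟦≤⟧ {0} {a} ℕ.z≤n

  ⟦⟧-pos : ∀ a → 1 ℕ.≤ a → Positive ⟦ a ⟧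
  ⟦⟧-pos a h rewrite ⟦⟧-normal a with h
  ... | ℕ.s≤s _ = _

  ⟦∑ˡ⟧-bound : ∀ {a} {A : Set a} (g : A → ℕ) (K : ℚ) (xs : List A) → All (λ x → ⟦ g x ⟧ ≤ K) xs →
    ⟦ ∑ˡ g xs ⟧ ≤ ⟦ length xs ⟧ * K
  ⟦∑ˡ⟧-bound g K [] [] = ≤-reflexive (sym (*-zeroˡ K))
  ⟦∑ˡ⟧-bound g K (x ∷ xs) (p ∷ ps) = begin
    ⟦ g x ℕ.+ ∑ˡ g xs ⟧         ≡⟨ ⟦+⟧ (g x) _ ⟩
    ⟦ g x ⟧ + ⟦ ∑ˡ g xs ⟧       ≤⟨ +-mono-≤ p (⟦∑ˡ⟧-bound g K xs ps) ⟩
    K + ⟦ length xs ⟧ * K       ≡⟨ solve 2 (λ K n → K :+ n :* K := (con 1ℚ :+ n) :* K) refl K ⟦ length xs ⟧ ⟩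
    (1ℚ + ⟦ length xs ⟧) * K    ≡⟨ cong (_* K) (sym (⟦+⟧ 1 (length xs))) ⟩
    ⟦ suc (length xs) ⟧ * K     ∎
    where open ≤-Reasoning

  denominator*q≡numerator : ∀ (q : ℚ) → NonNegative q → ⟦ ↧ₙ q ⟧ * q ≡ ⟦ ℤ.∣ ↥ q ∣ ⟧
  denominator*q≡numerator q@(mkℚ (+ n) d c) _ = toℚᵘ-injective (ℚᵘ.≃-trans (toℚᵘ-homo-* ⟦ suc d ⟧ q) cross)
    where
    cross : toℚᵘ ⟦ suc d ⟧ ℚᵘ.* toℚᵘ q ℚᵘ.≃ toℚᵘ ⟦ n ⟧
    cross rewrite ⟦⟧-normal (suc d) | ⟦⟧-normal n =
      ℚᵘ.*≡* (trans (ℤ.*-identityʳ _) (trans (ℤ.+◃n≡+n _) (trans (cong +_ n+d*n≡n*[1+d]) (ℤ.pos-* n (suc (d ℕ.+ 0))))))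
      where
      n+d*n≡n*[1+d] : n ℕ.+ d ℕ.* n ≡ n ℕ.* suc (d ℕ.+ 0)
      n+d*n≡n*[1+d] rewrite ℕ.+-identityʳ d = trans (cong (n ℕ.+_) (ℕ.*-comm d n)) (sym (ℕ.*-suc n d))

  numerator-pos : ∀ (q : ℚ) → Positive q → 1 ℕ.≤ ℤ.∣ ↥ q ∣
  numerator-pos (mkℚ +[1+ n ] d c) _ = ℕ.s≤s ℕ.z≤n

  0≤*0≤ : ∀ {x y} → 0ℚ ≤ x → 0ℚ ≤ y → 0ℚ ≤ x * y
  0≤*0≤ {x} {y} hx hy = ≤-trans (≤-reflexive (sym (*-zeroˡ y))) (*-monoʳ-≤-nonNeg y {{nonNegative hy}} hx)

  *-mono-≤ : ∀ {a b c d} → 0ℚ ≤ a → a ≤ b → 0ℚ ≤ c → c ≤ d → a * c ≤ b * d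
  *-mono-≤ {a} {b} {c} {d} 0≤a a≤b 0≤c c≤d =
    ≤-trans (*-monoʳ-≤-nonNeg c {{nonNegative 0≤c}} a≤b) (*-monoˡ-≤-nonNeg b {{nonNegative (≤-trans 0≤a a≤b)}} c≤d)

  swap-≤- : ∀ {x y z} → x ≤ y - z → z ≤ y - x
  swap-≤- {x} {y} {z} h = subst₂ _≤_ (solve 2 (λ x z → x :+ (z :- x) := z) refl x z)
    (solve 3 (λ x y z → y :- z :+ (z :- x) := y :- x) refl x y z) (+-monoˡ-≤ (z - x) h)

  +-cancelʳ-≤ : ∀ {a b c} → a + c ≤ b + c → a ≤ b
  +-cancelʳ-≤ {a} {b} {c} h = subst₂ _≤_ (solve 2 (λ a c → a :+ c :- c := a) refl a c)
    (solve 2 (λ b c → b :+ c :- c := b) refl b c) (+-monoˡ-≤ (- c) h)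

  x-y≤x : ∀ {x y} → 0ℚ ≤ y → x - y ≤ x
  x-y≤x {x} {y} h = subst₂ _≤_ (solve 2 (λ x y → x :- y :+ con 0ℚ := x :- y) refl x y)
    (solve 2 (λ x y → x :- y :+ y := x) refl x y) (+-monoʳ-≤ (x - y) h)

  ^ℚ-pos : ∀ x k → Positive x → Positive (x ^ℚ k)
  ^ℚ-pos x zero p = _
  ^ℚ-pos x (suc k) p = pos*pos⇒pos x {{p}} (x ^ℚ k) {{^ℚ-pos x k p}}

  0≤^ℚ : ∀ {x} k → 0ℚ ≤ x → 0ℚ ≤ x ^ℚ k
  0≤^ℚ zero h = 0≤⟦⟧ 1
  0≤^ℚ (suc k) h = 0≤*0≤ h (0≤^ℚ k h)

  ^ℚ-monoˡ-≤ : ∀ {x y} k → 0ℚ ≤ x → x ≤ y → x ^ℚ k ≤ y ^ℚ k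
  ^ℚ-monoˡ-≤ zero h x≤y = ≤-refl
  ^ℚ-monoˡ-≤ (suc k) h x≤y = *-mono-≤ h x≤y (0≤^ℚ k h) (^ℚ-monoˡ-≤ k h x≤y)

  ^ℚ-+ : ∀ x a b → x ^ℚ (a ℕ.+ b) ≡ x ^ℚ a * x ^ℚ b
  ^ℚ-+ x zero b = sym (*-identityˡ _)
  ^ℚ-+ x (suc a) b = trans (cong (x *_) (^ℚ-+ x a b)) (sym (*-assoc x _ _))

  ^ℚ-* : ∀ x a b → x ^ℚ (a ℕ.* b) ≡ (x ^ℚ a) ^ℚ b
  ^ℚ-* x a zero rewrite ℕ.*-zeroʳ a = refl
  ^ℚ-* x a (suc b) rewrite ℕ.*-suc a b = trans (^ℚ-+ x a (a ℕ.* b)) (cong (x ^ℚ a *_) (^ℚ-* x a b))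

  *-^ℚ : ∀ x y k → (x * y) ^ℚ k ≡ x ^ℚ k * y ^ℚ k
  *-^ℚ x y zero = refl
  *-^ℚ x y (suc k) rewrite *-^ℚ x y k = solve 4 (λ x y a b → x :* y :* (a :* b) := x :* a :* (y :* b)) refl x y (x ^ℚ k) (y ^ℚ k)

  ^ℚ≤1 : ∀ {x} k → 0ℚ ≤ x → x ≤ 1ℚ → x ^ℚ k ≤ 1ℚ
  ^ℚ≤1 zero h0 h1 = ≤-refl
  ^ℚ≤1 (suc k) h0 h1 = ≤-trans (*-mono-≤ h0 h1 (0≤^ℚ k h0) (^ℚ≤1 k h0 h1)) (≤-reflexive (*-identityˡ 1ℚ))

  ^ℚ-antitone : ∀ {x} a b → 0ℚ ≤ x → x ≤ 1ℚ → a ℕ.≤ b → x ^ℚ b ≤ x ^ℚ a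
  ^ℚ-antitone {x} a b h0 h1 a≤b rewrite sym (ℕ.m+[n∸m]≡n a≤b) | ^ℚ-+ x a (b ℕ.∸ a) =
    ≤-trans (*-monoˡ-≤-nonNeg (x ^ℚ a) {{nonNegative (0≤^ℚ a h0)}} (^ℚ≤1 (b ℕ.∸ a) h0 h1)) (≤-reflexive (*-identityʳ _))

  1≤^ℚ : ∀ {x} k → 1ℚ ≤ x → 1ℚ ≤ x ^ℚ k
  1≤^ℚ zero h = ≤-refl
  1≤^ℚ (suc k) h = ≤-trans (≤-reflexive (sym (*-identityˡ 1ℚ))) (*-mono-≤ (0≤⟦⟧ 1) h (0≤⟦⟧ 1) (1≤^ℚ k h))

module Probability where

  open import Defs
  open Sums
  open Families
  open RationalFacts
  open import Data.Nat as ℕ using (ℕ; zero; suc)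
  import Data.Nat.Properties as ℕ
  import Data.Integer as ℤ
  open import Data.Rational hiding (∣_∣)
  open import Data.Rational.Properties
  open import Data.Rational.Solver using (module +-*-Solver)
  open +-*-Solver using (solve; _:+_; _:*_; _:-_; _:=_; con)
  open import Data.Fin.Subset using (Subset; ∣_∣)
  open import Data.Fin.Subset.Properties using (∣p∣≤n)
  open import Data.List using (List; []; _∷_; length; filter)
  open import Data.List.Relation.Unary.All as All using (All; []; _∷_)
  open import Data.List.Relation.Unary.AllPairs using (AllPairs)
  open import Data.List.Relation.Binary.Sublist.Propositional using (_⊆_)
  open import Data.List.Relation.Binary.Sublist.Propositional.Properties using (All-resp-⊆; length-mono-≤)
  open import Data.Empty using (⊥-elim)
  open import Relation.Nullary using (Dec; yes; no; ¬_; ¬?)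
  open import Relation.Binary.PropositionalEquality

  few-outside⇒many-inside : ∀ (β : ℚ) → Positive β → ∀ out k m → out ℕ.+ k ≡ m →
    ⟦ out ⟧ ≤ (1ℚ - β) * ⟦ m ⟧ → m ℕ.≤ ↧ₙ β ℕ.* k
  few-outside⇒many-inside β pβ out k m out+k≡m out≤ =
    ℕ.≤-trans (ℕ.m≤n*m m n {{ℕ.>-nonZero (numerator-pos β pβ)}}) (⟦≤⟧⁻¹ scaled)
    where
    n = ℤ.∣ ↥ β ∣
    M = ↧ₙ β
    m-out≡k : ⟦ m ⟧ - ⟦ out ⟧ ≡ ⟦ k ⟧
    m-out≡k = trans (cong (λ w → ⟦ w ⟧ - ⟦ out ⟧) (sym out+k≡m))
      (trans (cong (_- ⟦ out ⟧) (⟦+⟧ out k)) (solve 2 (λ x y → x :+ y :- x := y) refl ⟦ out ⟧ ⟦ k ⟧))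
    βm≤k : β * ⟦ m ⟧ ≤ ⟦ k ⟧
    βm≤k = subst (β * ⟦ m ⟧ ≤_) m-out≡k (swap-≤- {⟦ out ⟧} {⟦ m ⟧} {β * ⟦ m ⟧} (subst (⟦ out ⟧ ≤_)
      (solve 2 (λ b m → (con 1ℚ :- b) :* m := m :- b :* m) refl β ⟦ m ⟧) out≤))
    scaled : ⟦ n ℕ.* m ⟧ ≤ ⟦ M ℕ.* k ⟧
    scaled = subst₂ _≤_
      (trans (sym (*-assoc ⟦ M ⟧ β ⟦ m ⟧)) (trans (cong (_* ⟦ m ⟧) (denominator*q≡numerator β (pos⇒nonNeg β {{pβ}}))) (sym (⟦*⟧ n m))))
      (sym (⟦*⟧ M k)) (*-monoˡ-≤-nonNeg ⟦ M ⟧ {{nonNegative (0≤⟦⟧ M)}} βm≤k)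

  complement-bound : ∀ good bad N (p : ℚ) → good ℕ.+ bad ≡ N → ⟦ bad ⟧ ≤ p * ⟦ N ⟧ → (1ℚ - p) * ⟦ N ⟧ ≤ ⟦ good ⟧
  complement-bound good bad N p good+bad≡N bad≤ = +-cancelʳ-≤ {c = ⟦ bad ⟧} (begin
    (1ℚ - p) * ⟦ N ⟧ + ⟦ bad ⟧    ≤⟨ +-monoʳ-≤ ((1ℚ - p) * ⟦ N ⟧) bad≤ ⟩
    (1ℚ - p) * ⟦ N ⟧ + p * ⟦ N ⟧  ≡⟨ solve 2 (λ p n → (con 1ℚ :- p) :* n :+ p :* n := n) refl p ⟦ N ⟧ ⟩
    ⟦ N ⟧                         ≡⟨ cong ⟦_⟧ (sym good+bad≡N) ⟩
    ⟦ good ℕ.+ bad ⟧              ≡⟨ ⟦+⟧ good bad ⟩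
    ⟦ good ⟧ + ⟦ bad ⟧            ∎)
    where open ≤-Reasoning

  good+bad : ∀ {a p} {A : Set a} {P : A → Set p} (P? : ∀ x → Dec (P x)) (xs : List A) →
    length (filter P? xs) ℕ.+ ∑ˡ (λ x → ind (¬? (P? x))) xs ≡ length xs
  good+bad P? xs = begin
    length (filter P? xs) ℕ.+ ∑ˡ (λ x → ind (¬? (P? x))) xs ≡⟨ cong (ℕ._+ ∑ˡ (λ x → ind (¬? (P? x))) xs) (length-filter-∑ˡ P? xs) ⟩
    ∑ˡ (λ x → ind (P? x)) xs ℕ.+ ∑ˡ (λ x → ind (¬? (P? x))) xs ≡⟨ sym (∑ˡ-+ (λ x → ind (P? x)) (λ x → ind (¬? (P? x))) xs) ⟩
    ∑ˡ (λ x → ind (P? x) ℕ.+ ind (¬? (P? x))) xs ≡⟨ ∑ˡ-cong _ _ xs (λ x → ind-¬ (P? x)) ⟩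
    ∑ˡ (λ _ → 1) xs ≡⟨ trans (∑ˡ-const 1 xs) (ℕ.*-identityʳ _) ⟩
    length xs ∎
    where open ≡-Reasoning

  -- With M the denominator of β and c = (β/2)^M we take
  -- μT = c μS^Δ / Δ!.  If f is bad, f maps a sublist L of 𝒮 with |L| ≥ |𝒮|/M
  -- into 𝒯; for each L at most c^|L| of all injections do so, and there are
  -- 2^|𝒮| sublists, so bad injections are at most 2^m (β/2)^m = β^m of all.

  module Count (Δ : ℕ) (Δ≥1 : 1 ℕ.≤ Δ) (β μS : ℚ) (pβ : Positive β) (pμS : Positive μS) where

    M : ℕ
    M = ↧ₙ β

    -- per set of L, the fraction of injections mapping all of L into 𝒯 is at most c
    c : ℚ
    c = (β * ½) ^ℚ M

    β/2-pos : Positive (β * ½)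
    β/2-pos = pos*pos⇒pos β {{pβ}} ½

    0≤β/2 : 0ℚ ≤ β * ½
    0≤β/2 = <⇒≤ (positive⁻¹ (β * ½) {{β/2-pos}})

    c-pos : Positive c
    c-pos = ^ℚ-pos (β * ½) M β/2-pos

    Δ!-pos : Positive ⟦ Δ ℕ.! ⟧
    Δ!-pos = ⟦⟧-pos (Δ ℕ.!) (ℕ.1≤n! Δ)

    1/Δ! : ℚ
    1/Δ! = (1/ ⟦ Δ ℕ.! ⟧) {{pos⇒nonZero ⟦ Δ ℕ.! ⟧ {{Δ!-pos}}}}

    μT : ℚ
    μT = c * μS ^ℚ Δ * 1/Δ!

    μT-pos : Positive μT
    μT-pos = pos*pos⇒pos (c * μS ^ℚ Δ) {{pos*pos⇒pos c {{c-pos}} (μS ^ℚ Δ) {{^ℚ-pos μS Δ pμS}}}}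
                         1/Δ! {{1/pos⇒pos ⟦ Δ ℕ.! ⟧ {{Δ!-pos}}}}

    module _ (s t : ℕ) (s≤t : s ℕ.≤ t) (𝒮 : List (Subset s)) (sizes𝒮 : All (λ A → ∣ A ∣ ≡ Δ) 𝒮)
             (disjoint𝒮 : AllPairs Disjoint 𝒮) (small𝒮 : ⟦ Δ ⟧ * ⟦ length 𝒮 ⟧ ≤ (1ℚ - μS) * ⟦ t ⟧)
             (𝒯 : List (Subset t)) (sizes𝒯 : All (λ B → ∣ B ∣ ≡ Δ) 𝒯) (small𝒯 : ⟦ length 𝒯 ⟧ ≤ μT * ⟦ t ⟧ ^ℚ Δ) where

      m = length 𝒮
      N = length (allInjections s t)
      -- points of T outside the image of 𝒮
      b = t ℕ.∸ m ℕ.* Δ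

      mΔ≤t-μSt : ⟦ m ℕ.* Δ ⟧ ≤ ⟦ t ⟧ - μS * ⟦ t ⟧
      mΔ≤t-μSt = subst₂ _≤_ (trans (sym (⟦*⟧ Δ m)) (cong ⟦_⟧ (ℕ.*-comm Δ m)))
        (solve 2 (λ u t → (con 1ℚ :- u) :* t := t :- u :* t) refl μS ⟦ t ⟧) small𝒮

      0≤μSt : 0ℚ ≤ μS * ⟦ t ⟧
      0≤μSt = 0≤*0≤ (<⇒≤ (positive⁻¹ μS {{pμS}})) (0≤⟦⟧ t)

      μSt≤b : μS * ⟦ t ⟧ ≤ ⟦ b ⟧
      μSt≤b = subst (μS * ⟦ t ⟧ ≤_) (sym (⟦-⟧ mΔ≤t)) (swap-≤- {⟦ m ℕ.* Δ ⟧} {⟦ t ⟧} {μS * ⟦ t ⟧} mΔ≤t-μSt)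
        where
        mΔ≤t : m ℕ.* Δ ℕ.≤ t
        mΔ≤t = ⟦≤⟧⁻¹ (≤-trans mΔ≤t-μSt (x-y≤x 0≤μSt))

      1≤b : 1 ℕ.≤ t → 1 ℕ.≤ b
      1≤b 1≤t = positive-below b μSt≤b
        where
        0<μSt : 0ℚ < μS * ⟦ t ⟧
        0<μSt = positive⁻¹ (μS * ⟦ t ⟧) {{pos*pos⇒pos μS {{pμS}} ⟦ t ⟧ {{⟦⟧-pos t 1≤t}}}}
        positive-below : ∀ n → μS * ⟦ t ⟧ ≤ ⟦ n ⟧ → 1 ℕ.≤ n
        positive-below zero μSt≤0 = ⊥-elim (<-irrefl refl (<-≤-trans 0<μSt μSt≤0))
        positive-below (suc n) _ = ℕ.s≤s ℕ.z≤n

      𝒯-sparse : ⟦ length 𝒯 ℕ.* Δ ℕ.! ⟧ ≤ c * ⟦ b ⟧ ^ℚ Δ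
      𝒯-sparse = begin
        ⟦ length 𝒯 ℕ.* Δ ℕ.! ⟧                        ≡⟨ ⟦*⟧ (length 𝒯) (Δ ℕ.!) ⟩
        ⟦ length 𝒯 ⟧ * ⟦ Δ ℕ.! ⟧                      ≤⟨ *-monoʳ-≤-nonNeg ⟦ Δ ℕ.! ⟧ {{nonNegative (0≤⟦⟧ (Δ ℕ.!))}} small𝒯 ⟩
        μT * ⟦ t ⟧ ^ℚ Δ * ⟦ Δ ℕ.! ⟧                   ≡⟨ solve 5 (λ c u r T D → c :* u :* r :* T :* D := c :* (u :* T) :* (r :* D))
                                                           refl c (μS ^ℚ Δ) 1/Δ! (⟦ t ⟧ ^ℚ Δ) ⟦ Δ ℕ.! ⟧ ⟩
        c * (μS ^ℚ Δ * ⟦ t ⟧ ^ℚ Δ) * (1/Δ! * ⟦ Δ ℕ.! ⟧) ≡⟨ cong₂ (λ x y → c * x * y) (sym (*-^ℚ μS ⟦ t ⟧ Δ))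
                                                           (*-inverseˡ ⟦ Δ ℕ.! ⟧ {{pos⇒nonZero ⟦ Δ ℕ.! ⟧ {{Δ!-pos}}}}) ⟩
        c * (μS * ⟦ t ⟧) ^ℚ Δ * 1ℚ                     ≡⟨ *-identityʳ _ ⟩
        c * (μS * ⟦ t ⟧) ^ℚ Δ                          ≤⟨ *-monoˡ-≤-nonNeg c {{pos⇒nonNeg c {{c-pos}}}} (^ℚ-monoˡ-≤ Δ 0≤μSt μSt≤b) ⟩
        c * ⟦ b ⟧ ^ℚ Δ                                 ∎
        where open ≤-Reasoning

      -- b^(|L|Δ) ≥ 1 for a sublist L of 𝒮: if L has a set, t ≥ Δ ≥ 1
      1≤b^ : ∀ L → All (λ A → ∣ A ∣ ≡ Δ) L → 1 ℕ.≤ b ℕ.^ (length L ℕ.* Δ)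
      1≤b^ [] _ = ℕ.≤-refl
      1≤b^ (A ∷ L) (size ∷ _) = ℕ.≤-trans (ℕ.≤-reflexive (sym (ℕ.^-zeroˡ (length (A ∷ L) ℕ.* Δ))))
        (ℕ.^-monoˡ-≤ (length (A ∷ L) ℕ.* Δ) (1≤b 1≤t))
        where
        1≤t : 1 ℕ.≤ t
        1≤t = ℕ.≤-trans Δ≥1 (ℕ.≤-trans (ℕ.≤-reflexive (sym size)) (ℕ.≤-trans (∣p∣≤n A) s≤t))

      countInto-small : ∀ L → L ⊆ 𝒮 → ⟦ countInto 𝒯 L ⟧ ≤ c ^ℚ length L * ⟦ N ⟧
      countInto-small L L⊆𝒮 = *-cancelʳ-≤-pos ⟦ B ⟧ {{⟦⟧-pos B (1≤b^ L sizesL)}} (begin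
        ⟦ countInto 𝒯 L ⟧ * ⟦ B ⟧ ≡⟨ sym (⟦*⟧ (countInto 𝒯 L) B) ⟩
        ⟦ countInto 𝒯 L ℕ.* B ⟧ ≤⟨ ⟦≤⟧ (countInto-scaled 𝒯 Δ L (AllPairs-resp-⊆ L⊆𝒮 disjoint𝒮) sizesL sizes𝒯 b b≤) ⟩
        ⟦ a ℕ.^ j ℕ.* N ⟧ ≡⟨ trans (⟦*⟧ (a ℕ.^ j) N) (cong (_* ⟦ N ⟧) (⟦^⟧ a j)) ⟩
        ⟦ a ⟧ ^ℚ j * ⟦ N ⟧ ≤⟨ *-monoʳ-≤-nonNeg ⟦ N ⟧ {{nonNegative (0≤⟦⟧ N)}} (^ℚ-monoˡ-≤ j (0≤⟦⟧ a) 𝒯-sparse) ⟩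
        (c * ⟦ b ⟧ ^ℚ Δ) ^ℚ j * ⟦ N ⟧ ≡⟨ cong (_* ⟦ N ⟧) (trans (*-^ℚ c (⟦ b ⟧ ^ℚ Δ) j) (cong (c ^ℚ j *_) ⟦B⟧≡)) ⟩
        c ^ℚ j * ⟦ B ⟧ * ⟦ N ⟧ ≡⟨ solve 3 (λ x y z → x :* y :* z := x :* z :* y) refl (c ^ℚ j) ⟦ B ⟧ ⟦ N ⟧ ⟩
        c ^ℚ j * ⟦ N ⟧ * ⟦ B ⟧ ∎)
        where
        open ≤-Reasoning
        j = length L
        B = b ℕ.^ (j ℕ.* Δ)
        a = length 𝒯 ℕ.* Δ ℕ.!
        sizesL : All (λ A → ∣ A ∣ ≡ Δ) L
        sizesL = All-resp-⊆ L⊆𝒮 sizes𝒮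
        b≤ : b ℕ.≤ t ℕ.∸ j ℕ.* Δ
        b≤ = ℕ.∸-monoʳ-≤ t (ℕ.*-monoˡ-≤ Δ (length-mono-≤ L⊆𝒮))
        ⟦B⟧≡ : (⟦ b ⟧ ^ℚ Δ) ^ℚ j ≡ ⟦ B ⟧
        ⟦B⟧≡ = trans (sym (^ℚ-* ⟦ b ⟧ Δ j)) (trans (cong (⟦ b ⟧ ^ℚ_) (ℕ.*-comm Δ j)) (sym (⟦^⟧ b (j ℕ.* Δ))))

      Large : List (Subset s) → Set
      Large L = m ℕ.≤ M ℕ.* length L

      Large? : ∀ L → Dec (Large L)
      Large? L = m ℕ.≤? M ℕ.* length L

      Good? : ∀ f → Dec ((1ℚ - β) * ⟦ m ⟧ < ⟦ countImageOutside f 𝒮 𝒯 ⟧)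
      Good? f = (1ℚ - β) * ⟦ m ⟧ <? ⟦ countImageOutside f 𝒮 𝒯 ⟧

      bad : ℕ
      bad = ∑ˡ (λ f → ind (¬? (Good? f))) (allInjections s t)

      bad⇒large : ∀ f → Injective f → ¬ ((1ℚ - β) * ⟦ m ⟧ < ⟦ countImageOutside f 𝒮 𝒯 ⟧) → Large (filter (MapsInto? 𝒯 f) 𝒮)
      bad⇒large f inj not-good = few-outside⇒many-inside β pβ _ _ m
        (outside+inside 𝒯 Δ Δ≥1 𝒮 disjoint𝒮 sizes𝒮 f inj) (≮⇒≥ not-good)

      large-sublist-bound : β ≤ 1ℚ → ∀ L → L ⊆ 𝒮 → ⟦ ind (Large? L) ℕ.* countInto 𝒯 L ⟧ ≤ (β * ½) ^ℚ m * ⟦ N ⟧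
      large-sublist-bound β≤1 L L⊆𝒮 = by-cases (Large? L)
        where
        β/2≤1 : β * ½ ≤ 1ℚ
        β/2≤1 = ≤-trans (*-monoʳ-≤-nonNeg ½ β≤1) (*≤* (ℤ.+≤+ (ℕ.s≤s ℕ.z≤n)))
        by-cases : (d : Dec (Large L)) → ⟦ ind d ℕ.* countInto 𝒯 L ⟧ ≤ (β * ½) ^ℚ m * ⟦ N ⟧
        by-cases (no _) = 0≤*0≤ (0≤^ℚ m 0≤β/2) (0≤⟦⟧ N)
        by-cases (yes large) = begin
          ⟦ countInto 𝒯 L ℕ.+ 0 ⟧ ≡⟨ cong ⟦_⟧ (ℕ.+-identityʳ (countInto 𝒯 L)) ⟩
          ⟦ countInto 𝒯 L ⟧ ≤⟨ countInto-small L L⊆𝒮 ⟩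
          c ^ℚ length L * ⟦ N ⟧ ≡⟨ cong (_* ⟦ N ⟧) (sym (^ℚ-* (β * ½) M (length L))) ⟩
          (β * ½) ^ℚ (M ℕ.* length L) * ⟦ N ⟧ ≤⟨ *-monoʳ-≤-nonNeg ⟦ N ⟧ {{nonNegative (0≤⟦⟧ N)}} (^ℚ-antitone m _ 0≤β/2 β/2≤1 large) ⟩
          (β * ½) ^ℚ m * ⟦ N ⟧ ∎
          where open ≤-Reasoning

      bad-bound : ⟦ bad ⟧ ≤ β ^ℚ m * ⟦ N ⟧
      bad-bound = by-cases (1ℚ ≤? β)
        where
        -- for β ≥ 1 there is nothing to prove
        β≥1 : 1ℚ ≤ β → ⟦ bad ⟧ ≤ β ^ℚ m * ⟦ N ⟧
        β≥1 1≤β = begin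
          ⟦ bad ⟧ ≤⟨ ⟦≤⟧ (ℕ.≤-trans (∑ˡ-bound _ 1 (allInjections s t) (All.universal (λ f → ind≤1 (¬? (Good? f))) _))
                                    (ℕ.≤-reflexive (ℕ.*-identityʳ N))) ⟩
          ⟦ N ⟧ ≡⟨ sym (*-identityˡ ⟦ N ⟧) ⟩
          1ℚ * ⟦ N ⟧ ≤⟨ *-monoʳ-≤-nonNeg ⟦ N ⟧ {{nonNegative (0≤⟦⟧ N)}} (1≤^ℚ m 1≤β) ⟩
          β ^ℚ m * ⟦ N ⟧ ∎
          where open ≤-Reasoning
        β<1 : β ≤ 1ℚ → ⟦ bad ⟧ ≤ β ^ℚ m * ⟦ N ⟧
        β<1 β≤1 = begin
          ⟦ bad ⟧ ≤⟨ ⟦≤⟧ (union-bound 𝒯 𝒮 (λ f → ¬? (Good? f)) Large? bad⇒large) ⟩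
          ⟦ ∑ˡ (λ L → ind (Large? L) ℕ.* countInto 𝒯 L) (sublists 𝒮) ⟧
            ≤⟨ ⟦∑ˡ⟧-bound _ _ (sublists 𝒮) (All.map (large-sublist-bound β≤1 _) (sublists-sound 𝒮)) ⟩
          ⟦ length (sublists 𝒮) ⟧ * ((β * ½) ^ℚ m * ⟦ N ⟧) ≡⟨ cong (_* ((β * ½) ^ℚ m * ⟦ N ⟧)) (trans (cong ⟦_⟧ (length-sublists 𝒮)) (⟦^⟧ 2 m)) ⟩
          ⟦ 2 ⟧ ^ℚ m * ((β * ½) ^ℚ m * ⟦ N ⟧) ≡⟨ sym (*-assoc (⟦ 2 ⟧ ^ℚ m) ((β * ½) ^ℚ m) ⟦ N ⟧) ⟩
          ⟦ 2 ⟧ ^ℚ m * (β * ½) ^ℚ m * ⟦ N ⟧ ≡⟨ cong (_* ⟦ N ⟧) (sym (*-^ℚ ⟦ 2 ⟧ (β * ½) m)) ⟩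
          (⟦ 2 ⟧ * (β * ½)) ^ℚ m * ⟦ N ⟧ ≡⟨ cong (λ x → x ^ℚ m * ⟦ N ⟧) (solve 1 (λ b → con ⟦ 2 ⟧ :* (b :* con ½) := b) refl β) ⟩
          β ^ℚ m * ⟦ N ⟧ ∎
          where open ≤-Reasoning
        by-cases : Dec (1ℚ ≤ β) → ⟦ bad ⟧ ≤ β ^ℚ m * ⟦ N ⟧
        by-cases (yes 1≤β) = β≥1 1≤β
        by-cases (no 1≰β) = β<1 (<⇒≤ (≰⇒> 1≰β))

      good-injections : (1ℚ - β ^ℚ m) * ⟦ N ⟧ ≤ ⟦ length (filter Good? (allInjections s t)) ⟧
      good-injections = complement-bound _ bad N (β ^ℚ m) (good+bad Good? (allInjections s t)) bad-bound

open import Defs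
open import Data.Nat as ℕ using (ℕ)
open import Data.Rational using (ℚ; 1ℚ; _*_; _-_; _≤_; Positive)
open import Data.Rational.Properties using (_<?_)
open import Data.Fin.Subset using (Subset; ∣_∣; _∩_; Empty)
open import Data.List using (List; length; filter)
open import Data.List.Relation.Unary.All using (All)
open import Data.List.Relation.Unary.AllPairs using (AllPairs)
open import Data.List.Relation.Unary.Unique.Propositional using (Unique)
open import Data.Product using (Σ; _×_; _,_)
open import Relation.Binary.PropositionalEquality using (_≡_)
open Probability using (module Count)

lemma11p9 : (Δ : ℕ) → 1 ℕ.≤ Δ → (β μS : ℚ) → Positive β → Positive μS →
    Σ ℚ λ μT → Positive μT ×
      ((s t : ℕ) → s ℕ.≤ t →
        (𝒮 : List (Subset s)) → All (λ A → ∣ A ∣ ≡ Δ) 𝒮 →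
        AllPairs (λ A B → Empty (A ∩ B)) 𝒮 →
        ⟦ Δ ⟧ * ⟦ length 𝒮 ⟧ ≤ (1ℚ - μS) * ⟦ t ⟧ →
        (𝒯 : List (Subset t)) → Unique 𝒯 → All (λ B → ∣ B ∣ ≡ Δ) 𝒯 →
        ⟦ length 𝒯 ⟧ ≤ μT * (⟦ t ⟧ ^ℚ Δ) →
        (1ℚ - (β ^ℚ length 𝒮)) * ⟦ length (allInjections s t) ⟧
          ≤ ⟦ length (filter (λ f → ((1ℚ - β) * ⟦ length 𝒮 ⟧) <? ⟦ countImageOutside f 𝒮 𝒯 ⟧)
                             (allInjections s t)) ⟧)
lemma11p9 Δ Δ≥1 β μS pβ pμS = μT , μT-pos ,
  λ s t s≤t 𝒮 sizes𝒮 disjoint𝒮 small𝒮 𝒯 _ sizes𝒯 small𝒯 →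
    good-injections s t s≤t 𝒮 sizes𝒮 disjoint𝒮 small𝒮 𝒯 sizes𝒯 small𝒯
  where open Count Δ Δ≥1 β μS pβ pμS
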